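{- Let $k\ge 2$, let $n \ge 2k$ and $0<\mu,\theta<1$. Suppose that $H$ is a $k$-graph on $n$ vertices that is $(\mu,\theta)$-dense. Then there exists a sub-$k$-graph $H'$ of $H$ on vertex set $V(H)$ that is strongly $(\mu - 2^k\theta^{1/(2k-2)},\ \theta+\theta^{1/(2k-2)})$-dense.
   Context: A $k$-graph is a $k$-uniform hypergraph; for a set $S$ of vertices, $\deg_H(S)$ is the number of edges of $H$ containing $S$. For $0\le\mu,\theta\le 1$, a $k$-graph $H$ on $n$ vertices is $(\mu,\theta)$-dense if there is a family $\mathcal{S}$ of at most $\theta\binom{n}{k-1}$ sets of size $k-1$ such that every $(k-1)$-set $S$ of vertices not in $\mathcal{S}$ satisfies $\deg_H(S)\ge \mu(n-k+1)$. It is strongly $(\mu,\theta)$-dense if it is $(\mu,\theta)$-dense and additionally, for every edge $e\in E(H)$ and every $(k-1)$-subset $X\subseteq e$, $\deg_H(X)\ge \mu(n-k+1)$.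
   Formalization: The parameters μ and θ range over the rationals rather than the reals. -}

module Defs where

open import Data.Nat as ℕ using (ℕ; zero; suc; _∸_)
open import Data.Nat.Combinatorics using (_C_)
open import Data.Integer using (+_)
open import Data.Rational using (ℚ; _/_; _*_; _-_; _+_; _≤_; 1ℚ; 0ℚ)
open import Data.Bool using (Bool; T; _∧_)
open import Data.Bool.Properties using (T?)
open import Data.Fin.Subset using (Subset; inside; outside; _⊆_; ∣_∣)
open import Data.Fin.Subset.Properties using (_⊆?_)
open import Data.List using (List; []; _∷_; map; _++_; length; filter)
open import Data.Vec using (_∷_; [])
open import Data.Product using (_×_; Σ)
open import Data.Empty using (⊥)
open import Relation.Binary.PropositionalEquality using (_≡_)
open import Data.Sum using (_⊎_)
open import Relation.Nullary.Decidable using (_×-dec_)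

ℕ→ℚ : ℕ → ℚ
ℕ→ℚ n = + n / 1

_^ℚ_ : ℚ → ℕ → ℚ
x ^ℚ zero = 1ℚ
x ^ℚ suc m = x * (x ^ℚ m)

allSubsets : (n : ℕ) → List (Subset n)
allSubsets zero = [] ∷ []
allSubsets (suc n) = map (inside ∷_) (allSubsets n) ++ map (outside ∷_) (allSubsets n)

record KGraph (k n : ℕ) : Set where
  field
    edge    : Subset n → Bool
    uniform : ∀ (e : Subset n) → T (edge e) → ∣ e ∣ ≡ k


open KGraph public

deg : ∀ {k n} → KGraph k n → Subset n → ℕ
deg {n = n} H S = length (filter (λ e → T? (edge H e) ×-dec (S ⊆? e)) (allSubsets n))

_⊑_ : ∀ {k n} → KGraph k n → KGraph k n → Set
H' ⊑ H = ∀ e → T (edge H' e) → T (edge H e)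

familySize : ∀ {n} (j : ℕ) → (Subset n → Bool) → ℕ
familySize {n} j 𝒮 = length (filter (λ S → T? (𝒮 S) ×-dec (∣ S ∣ ℕ.≟ j)) (allSubsets n))

DenseWrt : ∀ {k n} → KGraph k n → (ℕ → Set) → (ℕ → Set) → Set
DenseWrt {k} {n} H DegOK SizeOK =
  Σ (Subset n → Bool) λ 𝒮 →
    SizeOK (familySize (k ∸ 1) 𝒮) ×
    (∀ (S : Subset n) → ∣ S ∣ ≡ k ∸ 1 → ¬T (𝒮 S) → DegOK (deg H S))
  where
    ¬T : Bool → Set
    ¬T b = T b → ⊥

StronglyDenseWrt : ∀ {k n} → KGraph k n → (ℕ → Set) → (ℕ → Set) → Set
StronglyDenseWrt {k} {n} H DegOK SizeOK =
  DenseWrt H DegOK SizeOK ×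
  (∀ (e X : Subset n) → T (edge H e) → X ⊆ e → ∣ X ∣ ≡ k ∸ 1 → DegOK (deg H X))

Dense : ∀ {k n} → KGraph k n → ℚ → ℚ → Set
Dense {k} {n} H μ θ =
  DenseWrt H (λ d → μ * ℕ→ℚ (n ∸ k ℕ.+ 1) ≤ ℕ→ℚ d)
             (λ s → ℕ→ℚ s ≤ θ * ℕ→ℚ (n C (k ∸ 1)))

-- x ≤ a · θ^{1/m}   (for a ≥ 0, θ ≥ 0, m ≥ 1), expressed without irrational roots:
-- either x ≤ 0, or x^m ≤ θ · a^m.
LeMulRoot : (m : ℕ) (θ a x : ℚ) → Set
LeMulRoot m θ a x = (x ≤ 0ℚ) ⊎ (x ^ℚ m ≤ θ * (a ^ℚ m))

-- With t = θ^{1/(2k-2)}, N = n-k+1, C = C(n,k-1):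
--   (μ - 2^k t)·N ≤ d   ⇔   μN - d ≤ (2^k N)·t
--   s ≤ (θ + t)·C       ⇔   s - θC ≤ C·t
StronglyDenseShifted : ∀ {k n} → KGraph k n → ℚ → ℚ → Set
StronglyDenseShifted {k} {n} H μ θ =
  StronglyDenseWrt H
    (λ d → LeMulRoot m θ (ℕ→ℚ (2 ℕ.^ k ℕ.* N)) (μ * ℕ→ℚ N - ℕ→ℚ d))
    (λ s → LeMulRoot m θ (ℕ→ℚ Cnk) (ℕ→ℚ s - θ * ℕ→ℚ Cnk))
  where
    m = 2 ℕ.* k ∸ 2
    N = n ∸ k ℕ.+ 1
    Cnk = n C (k ∸ 1)

{-# OPTIONS --safe #-}
module Submission where

-- Write K = k − 1, m = 2K and N = n − K.  If μ ≤ 2^k θ^{1/m} the degree condition is void and H itself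
-- will do.  Otherwise let q = ⌊θ^{−1/m}⌋, so that q ≥ 2^k.  Call a K-set bad if it lies in the exceptional
-- family 𝒮, and a smaller set Z bad if more than N/q of the sets covering Z (one element larger) are bad;
-- H' keeps the edges that contain no bad set.  A K-set X containing no bad set loses at most 2^K N/q edges:
-- a lost edge X ∪ {v} contains a bad W ⊈ X, and W = (W ∩ X) ∪ {v} is a bad cover of the non-bad set W ∩ X.
-- Double counting gives N β_j ≤ qK β_{j+1} for the number β_j of bad j-sets, so β_0 = 0 because
-- β_K ≤ θ C(n,K) ≤ C(n,K)/q^m; and the numbers τ_j of j-sets containing a bad set satisfy
-- τ_{j+1} ≤ β_{j+1} + n τ_j, whence τ_K ≤ β_K + C(n,K)/(2q).  As 1/(q+1) < θ^{1/m}, these are the two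
-- bounds that strong (μ − 2^k θ^{1/m}, θ + θ^{1/m})-density asks for.

open import Data.Bool using (Bool)
open import Data.Fin.Subset using (Subset)
open import Data.Nat using (ℕ)
open import Defs

module Counting where

  open import Data.Bool using (true; false; _∧_; not)
  open import Data.Fin.Subset using (inside; outside)
  open import Data.List using (List; []; _∷_; _++_; map; length; filter)
  open import Data.List.Properties using (length-++; filter-++)
  open import Data.Nat using (zero; suc; _+_; _*_; _≤_; z≤n)
  open import Data.Nat.Properties
  open import Algebra.Properties.CommutativeSemigroup +-commutativeSemigroup using (interchange)
  open import Data.Product using (∃; _,_)
  open import Data.Vec using ([]; _∷_)
  open import Function using (_∘_)
  open import Level using (Level)
  open import Relation.Binary.PropositionalEquality
  open import Relation.Nullary using (yes; no; does; ¬_; contradiction)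
  open import Relation.Unary using (Pred; Decidable)
  open import Relation.Unary.Properties using (_∩?_; ∁?)

  private variable
    n m a b : ℕ
    p q r : Level

  ∑ : (Subset n → ℕ) → ℕ
  ∑ {zero}  f = f []
  ∑ {suc n} f = ∑ (f ∘ (inside ∷_)) + ∑ (f ∘ (outside ∷_))

  ∑-cong : {f g : Subset n → ℕ} → (∀ x → f x ≡ g x) → ∑ f ≡ ∑ g
  ∑-cong {zero}  f≗g = f≗g []
  ∑-cong {suc n} f≗g = cong₂ _+_ (∑-cong (f≗g ∘ (inside ∷_))) (∑-cong (f≗g ∘ (outside ∷_)))

  ∑-mono-≤ : {f g : Subset n → ℕ} → (∀ x → f x ≤ g x) → ∑ f ≤ ∑ g
  ∑-mono-≤ {zero}  f≤g = f≤g []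
  ∑-mono-≤ {suc n} f≤g = +-mono-≤ (∑-mono-≤ (f≤g ∘ (inside ∷_))) (∑-mono-≤ (f≤g ∘ (outside ∷_)))

  ∑-distrib-+ : (f g : Subset n → ℕ) → ∑ (λ x → f x + g x) ≡ ∑ f + ∑ g
  ∑-distrib-+ {zero}  f g = refl
  ∑-distrib-+ {suc n} f g =
    trans (cong₂ _+_ (∑-distrib-+ (f ∘ (inside ∷_)) (g ∘ (inside ∷_)))
                      (∑-distrib-+ (f ∘ (outside ∷_)) (g ∘ (outside ∷_))))
          (interchange (∑ (f ∘ (inside ∷_))) (∑ (g ∘ (inside ∷_))) (∑ (f ∘ (outside ∷_))) (∑ (g ∘ (outside ∷_))))

  ∑-*ˡ : ∀ c (f : Subset n → ℕ) → ∑ (λ x → c * f x) ≡ c * ∑ f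
  ∑-*ˡ {zero}  c f = refl
  ∑-*ˡ {suc n} c f =
    trans (cong₂ _+_ (∑-*ˡ c (f ∘ (inside ∷_))) (∑-*ˡ c (f ∘ (outside ∷_)))) (sym (*-distribˡ-+ c _ _))

  ∑-comm : (f : Subset n → Subset m → ℕ) → ∑ (λ x → ∑ (f x)) ≡ ∑ (λ y → ∑ (λ x → f x y))
  ∑-comm {zero}  f = refl
  ∑-comm {suc n} f =
    trans (cong₂ _+_ (∑-comm (f ∘ (inside ∷_))) (∑-comm (f ∘ (outside ∷_))))
          (sym (∑-distrib-+ (λ y → ∑ λ x → f (inside ∷ x) y) (λ y → ∑ λ x → f (outside ∷ x) y)))

  ≤-∑ : (f : Subset n → ℕ) (x : Subset n) → f x ≤ ∑ f
  ≤-∑ {zero}  f []            = ≤-refl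
  ≤-∑ {suc n} f (inside ∷ x)  = ≤-trans (≤-∑ (f ∘ (inside ∷_)) x) (m≤m+n _ _)
  ≤-∑ {suc n} f (outside ∷ x) = ≤-trans (≤-∑ (f ∘ (outside ∷_)) x) (m≤n+m _ _)

  indicator : Bool → ℕ
  indicator true  = 1
  indicator false = 0

  count : {P : Pred (Subset n) p} → Decidable P → ℕ
  count P? = ∑ λ x → indicator (does (P? x))

  module _ {P : Pred (Subset n) p} (P? : Decidable P) where

    *-count≤∑ : {f : Subset n → ℕ} → (∀ x → P x → a ≤ f x) → a * count P? ≤ ∑ f
    *-count≤∑ {a = a} {f} a≤f = ≤-trans (≤-reflexive (sym (∑-*ˡ a λ x → indicator (does (P? x))))) (∑-mono-≤ term)
      where
      term : ∀ x → a * indicator (does (P? x)) ≤ f x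
      term x with P? x
      ... | yes px = ≤-trans (≤-reflexive (*-identityʳ a)) (a≤f x px)
      ... | no  _  = ≤-trans (≤-reflexive (*-zeroʳ a)) z≤n

    ∑≤*-count : {f : Subset n → ℕ} → (∀ x → P x → f x ≤ b) → (∀ x → ¬ P x → f x ≡ 0) → ∑ f ≤ b * count P?
    ∑≤*-count {b = b} {f} f≤b f≡0 = ≤-trans (∑-mono-≤ term) (≤-reflexive (∑-*ˡ b λ x → indicator (does (P? x))))
      where
      term : ∀ x → f x ≤ b * indicator (does (P? x))
      term x with P? x
      ... | yes px  = ≤-trans (f≤b x px) (≤-reflexive (sym (*-identityʳ b)))
      ... | no  ¬px = ≤-trans (≤-reflexive (f≡0 x ¬px)) z≤n

    count-none : (∀ x → ¬ P x) → count P? ≡ 0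
    count-none ¬P = n≤0⇒n≡0 (∑≤*-count {b = 0} (λ x px → contradiction px (¬P x)) term)
      where
      term : ∀ x → ¬ P x → indicator (does (P? x)) ≡ 0
      term x ¬px with P? x
      ... | yes px = contradiction px ¬px
      ... | no  _  = refl

    count-split : {Q : Pred (Subset n) q} (Q? : Decidable Q) → count P? ≡ count (P? ∩? Q?) + count (P? ∩? ∁? Q?)
    count-split Q? = trans (∑-cong term) (∑-distrib-+ (λ x → indicator (does ((P? ∩? Q?) x)))
                                                               (λ x → indicator (does ((P? ∩? ∁? Q?) x))))
      where
      term : ∀ x → indicator (does (P? x)) ≡
                   indicator (does (P? x) ∧ does (Q? x)) + indicator (does (P? x) ∧ not (does (Q? x)))
      term x with does (P? x) | does (Q? x)
      ... | true  | true  = refl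
      ... | true  | false = refl
      ... | false | _     = refl

    count-mono : {Q : Pred (Subset n) q} (Q? : Decidable Q) → (∀ x → P x → Q x) → count P? ≤ count Q?
    count-mono Q? P⇒Q = ∑-mono-≤ term
      where
      term : ∀ x → indicator (does (P? x)) ≤ indicator (does (Q? x))
      term x with P? x | Q? x
      ... | yes _  | yes _  = ≤-refl
      ... | yes px | no ¬qx = contradiction (P⇒Q x px) ¬qx
      ... | no  _  | _      = z≤n

    count≤∑-count : {R : Subset m → Pred (Subset n) r} (R? : ∀ y → Decidable (R y)) →
                    (∀ x → P x → ∃ λ y → R y x) → count P? ≤ ∑ λ y → count (R? y)
    count≤∑-count R? cover = ≤-trans (∑-mono-≤ term) (≤-reflexive (∑-comm λ x y → indicator (does (R? y x))))
      where
      term : ∀ x → indicator (does (P? x)) ≤ ∑ λ y → indicator (does (R? y x))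
      term x with P? x
      ... | no  _  = z≤n
      ... | yes px with y , ryx ← cover x px with R? y x | ≤-∑ (λ y → indicator (does (R? y x))) y
      ...   | yes _   | 1≤∑ = 1≤∑
      ...   | no  ¬ryx | _  = contradiction ryx ¬ryx

  count-cong : {P : Pred (Subset n) p} {Q : Pred (Subset n) q} (P? : Decidable P) (Q? : Decidable Q) →
               (∀ x → P x → Q x) → (∀ x → Q x → P x) → count P? ≡ count Q?
  count-cong P? Q? P⇒Q Q⇒P = ≤-antisym (count-mono P? Q? P⇒Q) (count-mono Q? P? Q⇒P)

  length-filter-map : {A : Set} {P : Pred (Subset n) p} (P? : Decidable P) (g : A → Subset n) (xs : List A) →
                      length (filter P? (map g xs)) ≡ length (filter (P? ∘ g) xs)
  length-filter-map P? g []       = refl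
  length-filter-map P? g (x ∷ xs) with does (P? (g x))
  ... | true  = cong suc (length-filter-map P? g xs)
  ... | false = length-filter-map P? g xs

  length-filter-allSubsets : {P : Pred (Subset n) p} (P? : Decidable P) → length (filter P? (allSubsets n)) ≡ count P?
  length-filter-allSubsets {zero}  P? with does (P? [])
  ... | true  = refl
  ... | false = refl
  length-filter-allSubsets {suc n} P? = begin
    length (filter P? (map (inside ∷_) subsets ++ map (outside ∷_) subsets))
      ≡⟨ cong length (filter-++ P? (map (inside ∷_) subsets) (map (outside ∷_) subsets)) ⟩
    length (filter P? (map (inside ∷_) subsets) ++ filter P? (map (outside ∷_) subsets))
      ≡⟨ length-++ (filter P? (map (inside ∷_) subsets)) ⟩
    length (filter P? (map (inside ∷_) subsets)) + length (filter P? (map (outside ∷_) subsets))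
      ≡⟨ cong₂ _+_ (length-filter-map P? (inside ∷_) subsets) (length-filter-map P? (outside ∷_) subsets) ⟩
    length (filter (P? ∘ (inside ∷_)) subsets) + length (filter (P? ∘ (outside ∷_)) subsets)
      ≡⟨ cong₂ _+_ (length-filter-allSubsets (P? ∘ (inside ∷_))) (length-filter-allSubsets (P? ∘ (outside ∷_))) ⟩
    count P? ∎
    where
    open ≡-Reasoning
    subsets : List (Subset n)
    subsets = allSubsets n

open Counting

module Covering where

  open import Data.Empty using (⊥-elim)
  open import Data.Fin.Subset using (inside; outside; _⊆_; _⊈_; ∣_∣; _∪_; _∩_; _─_)
  open import Data.Fin.Subset.Properties using (_⊆?_; drop-∷-⊆; out⊆; in⊆in; ⊆-refl; p⊆q⇒∣p∣≤∣q∣; p⊆p∪q)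
  open import Data.Nat using (suc; _+_; _^_; _≤_; z≤n; _≟_)
  open import Data.Nat.Properties
  open import Data.Product using (∃; _×_; _,_; proj₁)
  open import Data.Vec using ([]; _∷_; here)
  open import Function using (_∘_; case_of_)
  open import Level using (Level)
  open import Relation.Binary.PropositionalEquality
  open import Relation.Nullary using (Dec; ¬_; contradiction; _×-dec_)
  open import Relation.Unary using (Pred; Decidable)

  private variable
    n : ℕ
    ℓ : Level
    p q W X Z e : Subset n

  in⊈out : ¬ (inside ∷ p ⊆ outside ∷ q)
  in⊈out p⊆q = case p⊆q here of λ ()

  infix 4 _⊆[_]_ _⊆[_]?_ _⋖_ _⋖?_

  _⊆[_]_ : Subset n → ℕ → Subset n → Set
  Z ⊆[ d ] Y = Z ⊆ Y × ∣ Y ∣ ≡ d + ∣ Z ∣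

  _⊆[_]?_ : (Z : Subset n) (d : ℕ) (Y : Subset n) → Dec (Z ⊆[ d ] Y)
  Z ⊆[ d ]? Y = Z ⊆? Y ×-dec ∣ Y ∣ ≟ d + ∣ Z ∣

  _⋖_ : Subset n → Subset n → Set
  Z ⋖ Y = Z ⊆[ 1 ] Y

  _⋖?_ : (Z Y : Subset n) → Dec (Z ⋖ Y)
  Z ⋖? Y = Z ⊆[ 1 ]? Y

  out⊈[0]in : ¬ (outside ∷ p ⊆[ 0 ] inside ∷ q)
  out⊈[0]in {q = q} (p⊆q , ∣q∣<∣p∣) = ≤⇒≯ (p⊆q⇒∣p∣≤∣q∣ (drop-∷-⊆ p⊆q)) (≤-reflexive ∣q∣<∣p∣)

  ⊆[0]⇒≡ : p ⊆[ 0 ] q → p ≡ q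
  ⊆[0]⇒≡ {p = []}          {[]}          _             = refl
  ⊆[0]⇒≡ {p = inside  ∷ p} {inside  ∷ q} (p⊆q , ∣q∣≡∣p∣) =
    cong (inside ∷_) (⊆[0]⇒≡ (drop-∷-⊆ p⊆q , suc-injective ∣q∣≡∣p∣))
  ⊆[0]⇒≡ {p = outside ∷ p} {outside ∷ q} (p⊆q , ∣q∣≡∣p∣) =
    cong (outside ∷_) (⊆[0]⇒≡ (drop-∷-⊆ p⊆q , ∣q∣≡∣p∣))
  ⊆[0]⇒≡ {p = inside  ∷ p} {outside ∷ q} (p⊆q , _)      = ⊥-elim (in⊈out p⊆q)
  ⊆[0]⇒≡ {p = outside ∷ p} {inside  ∷ q} p⊆[0]q         = ⊥-elim (out⊈[0]in p⊆[0]q)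

  count-subsets : (X : Subset n) → count (_⊆? X) ≡ 2 ^ ∣ X ∣
  count-subsets []            = refl
  count-subsets (inside ∷ X)  = trans (cong₂ _+_ (count-subsets X) (count-subsets X))
                                      (cong (2 ^ ∣ X ∣ +_) (sym (+-identityʳ _)))
  count-subsets (outside ∷ X) = cong₂ _+_ (count-none (λ Y → inside ∷ Y ⊆? outside ∷ X) (λ _ → in⊈out)) (count-subsets X)

  count-⊆[0]-supersets : (Z : Subset n) → count (Z ⊆[ 0 ]?_) ≤ 1
  count-⊆[0]-supersets []            = ≤-refl
  count-⊆[0]-supersets (inside ∷ Z)  =
    +-mono-≤ (count-⊆[0]-supersets Z)
             (≤-reflexive (count-none (λ Y → inside ∷ Z ⊆[ 0 ]? outside ∷ Y) (λ _ → in⊈out ∘ proj₁)))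
  count-⊆[0]-supersets (outside ∷ Z) =
    +-mono-≤ (≤-reflexive (count-none (λ Y → outside ∷ Z ⊆[ 0 ]? inside ∷ Y) (λ _ → out⊈[0]in)))
             (count-⊆[0]-supersets Z)

  count-⊆[0]-subsets : (Y : Subset n) → count (_⊆[ 0 ]? Y) ≤ 1
  count-⊆[0]-subsets []            = ≤-refl
  count-⊆[0]-subsets (inside ∷ Y)  =
    +-mono-≤ (count-⊆[0]-subsets Y)
             (≤-reflexive (count-none (λ Z → outside ∷ Z ⊆[ 0 ]? inside ∷ Y) (λ _ → out⊈[0]in)))
  count-⊆[0]-subsets (outside ∷ Y) =
    +-mono-≤ (≤-reflexive (count-none (λ Z → inside ∷ Z ⊆[ 0 ]? outside ∷ Y) (λ _ → in⊈out ∘ proj₁)))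
             (count-⊆[0]-subsets Y)

  count-covered : (Y : Subset n) → count (_⋖? Y) ≤ ∣ Y ∣
  count-covered []            = z≤n
  count-covered (inside ∷ Y)  =
    ≤-trans (+-mono-≤ (count-covered Y) (count-⊆[0]-subsets Y)) (≤-reflexive (+-comm ∣ Y ∣ 1))
  count-covered (outside ∷ Y) =
    +-mono-≤ (≤-reflexive (count-none (λ Z → inside ∷ Z ⋖? outside ∷ Y) (λ _ → in⊈out ∘ proj₁)))
             (count-covered Y)

  count-covers : (Z : Subset n) → count (Z ⋖?_) ≤ n
  count-covers []            = z≤n
  count-covers (inside ∷ Z)  =
    ≤-trans (+-mono-≤ (count-covers Z)
                      (≤-reflexive (count-none (λ Y → inside ∷ Z ⋖? outside ∷ Y) (λ _ → in⊈out ∘ proj₁))))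
            (≤-trans (≤-reflexive (+-identityʳ _)) (n≤1+n _))
  count-covers (outside ∷ Z) = +-mono-≤ (count-⊆[0]-supersets Z) (count-covers Z)

  private
    suc-+-suc : ∀ {a b c d} → a + b ≡ c + d → a + suc b ≡ c + suc d
    suc-+-suc {a} {b} {c} {d} eq = trans (+-suc a b) (trans (cong suc eq) (sym (+-suc c d)))

  ∣p∪r─q∣+∣q∣≡∣p∣+∣r∣ : Z ⊆ X → X ⊆ e → ∣ Z ∪ (e ─ X) ∣ + ∣ X ∣ ≡ ∣ Z ∣ + ∣ e ∣
  ∣p∪r─q∣+∣q∣≡∣p∣+∣r∣ {Z = []}          {[]}          {[]}          _   _   = refl
  ∣p∪r─q∣+∣q∣≡∣p∣+∣r∣ {Z = inside  ∷ Z} {inside  ∷ X} {inside  ∷ e} Z⊆X X⊆e =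
    cong suc (suc-+-suc (∣p∪r─q∣+∣q∣≡∣p∣+∣r∣ (drop-∷-⊆ Z⊆X) (drop-∷-⊆ X⊆e)))
  ∣p∪r─q∣+∣q∣≡∣p∣+∣r∣ {Z = outside ∷ Z} {inside  ∷ X} {inside  ∷ e} Z⊆X X⊆e =
    suc-+-suc (∣p∪r─q∣+∣q∣≡∣p∣+∣r∣ (drop-∷-⊆ Z⊆X) (drop-∷-⊆ X⊆e))
  ∣p∪r─q∣+∣q∣≡∣p∣+∣r∣ {Z = outside ∷ Z} {outside ∷ X} {inside  ∷ e} Z⊆X X⊆e =
    trans (cong suc (∣p∪r─q∣+∣q∣≡∣p∣+∣r∣ (drop-∷-⊆ Z⊆X) (drop-∷-⊆ X⊆e))) (sym (+-suc ∣ Z ∣ ∣ e ∣))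
  ∣p∪r─q∣+∣q∣≡∣p∣+∣r∣ {Z = outside ∷ Z} {outside ∷ X} {outside ∷ e} Z⊆X X⊆e =
    ∣p∪r─q∣+∣q∣≡∣p∣+∣r∣ (drop-∷-⊆ Z⊆X) (drop-∷-⊆ X⊆e)
  ∣p∪r─q∣+∣q∣≡∣p∣+∣r∣ {Z = inside  ∷ Z} {outside ∷ X} Z⊆X _   = ⊥-elim (in⊈out Z⊆X)
  ∣p∪r─q∣+∣q∣≡∣p∣+∣r∣ {X = inside  ∷ X} {outside ∷ e} _   X⊆e = ⊥-elim (in⊈out X⊆e)

  p⊆q⋖r⇒p⋖p∪r─q : Z ⊆ X → X ⋖ e → Z ⋖ Z ∪ (e ─ X)
  p⊆q⋖r⇒p⋖p∪r─q {Z = Z} {X} {e} Z⊆X (X⊆e , ∣e∣≡1+∣X∣) = p⊆p∪q (e ─ X) , +-cancelʳ-≡ ∣ X ∣ _ _ (begin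
    ∣ Z ∪ (e ─ X) ∣ + ∣ X ∣ ≡⟨ ∣p∪r─q∣+∣q∣≡∣p∣+∣r∣ Z⊆X X⊆e ⟩
    ∣ Z ∣ + ∣ e ∣           ≡⟨ cong (∣ Z ∣ +_) ∣e∣≡1+∣X∣ ⟩
    ∣ Z ∣ + suc ∣ X ∣       ≡⟨ +-suc ∣ Z ∣ ∣ X ∣ ⟩
    suc ∣ Z ∣ + ∣ X ∣       ∎)
    where open ≡-Reasoning

  private
    p∩q∪q─q≡p : W ⊆ X → (W ∩ X) ∪ (X ─ X) ≡ W
    p∩q∪q─q≡p {W = []}          {[]}          _   = refl
    p∩q∪q─q≡p {W = inside  ∷ W} {inside  ∷ X} W⊆X = cong (inside ∷_) (p∩q∪q─q≡p (drop-∷-⊆ W⊆X))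
    p∩q∪q─q≡p {W = outside ∷ W} {inside  ∷ X} W⊆X = cong (outside ∷_) (p∩q∪q─q≡p (drop-∷-⊆ W⊆X))
    p∩q∪q─q≡p {W = outside ∷ W} {outside ∷ X} W⊆X = cong (outside ∷_) (p∩q∪q─q≡p (drop-∷-⊆ W⊆X))
    p∩q∪q─q≡p {W = inside  ∷ W} {outside ∷ X} W⊆X = ⊥-elim (in⊈out W⊆X)

  p∩q∪r─q≡p : W ⊆ e → X ⋖ e → W ⊈ X → (W ∩ X) ∪ (e ─ X) ≡ W
  p∩q∪r─q≡p {W = []} {[]} {[]} _ (_ , ()) _
  p∩q∪r─q≡p {W = inside ∷ W} {inside ∷ e} {inside ∷ X} W⊆e (X⊆e , ∣e∣≡1+∣X∣) W⊈X =
    cong (inside ∷_) (p∩q∪r─q≡p (drop-∷-⊆ W⊆e) (drop-∷-⊆ X⊆e , suc-injective ∣e∣≡1+∣X∣) (W⊈X ∘ in⊆in))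
  p∩q∪r─q≡p {W = outside ∷ W} {inside ∷ e} {inside ∷ X} W⊆e (X⊆e , ∣e∣≡1+∣X∣) W⊈X =
    cong (outside ∷_) (p∩q∪r─q≡p (drop-∷-⊆ W⊆e) (drop-∷-⊆ X⊆e , suc-injective ∣e∣≡1+∣X∣) (W⊈X ∘ out⊆))
  p∩q∪r─q≡p {W = outside ∷ W} {outside ∷ e} {outside ∷ X} W⊆e (X⊆e , ∣e∣≡1+∣X∣) W⊈X =
    cong (outside ∷_) (p∩q∪r─q≡p (drop-∷-⊆ W⊆e) (drop-∷-⊆ X⊆e , ∣e∣≡1+∣X∣) (W⊈X ∘ out⊆))
  p∩q∪r─q≡p {W = inside ∷ W} {inside ∷ e} {outside ∷ X} W⊆e (X⊆e , ∣e∣≡1+∣X∣) W⊈X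
    with refl ← ⊆[0]⇒≡ (drop-∷-⊆ X⊆e , suc-injective ∣e∣≡1+∣X∣)
    = cong (inside ∷_) (p∩q∪q─q≡p (drop-∷-⊆ W⊆e))
  p∩q∪r─q≡p {W = outside ∷ W} {inside ∷ e} {outside ∷ X} W⊆e (X⊆e , ∣e∣≡1+∣X∣) W⊈X
    with refl ← ⊆[0]⇒≡ (drop-∷-⊆ X⊆e , suc-injective ∣e∣≡1+∣X∣) = ⊥-elim (W⊈X (out⊆ (drop-∷-⊆ W⊆e)))
  p∩q∪r─q≡p {W = inside ∷ W} {outside ∷ e} W⊆e _ _ = ⊥-elim (in⊈out W⊆e)
  p∩q∪r─q≡p {e = outside ∷ e} {inside ∷ X} _ (X⊆e , _) _ = ⊥-elim (in⊈out X⊆e)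

  ⊊⇒⊆⋖ : W ⊆ X → W ≢ X → ∃ λ Z → W ⊆ Z × Z ⋖ X
  ⊊⇒⊆⋖ {W = []}          {[]}          _   W≢X = contradiction refl W≢X
  ⊊⇒⊆⋖ {W = inside  ∷ W} {inside  ∷ X} W⊆X W≢X
    with Z , W⊆Z , (Z⊆X , ∣X∣≡1+∣Z∣) ← ⊊⇒⊆⋖ (drop-∷-⊆ W⊆X) (W≢X ∘ cong (inside ∷_))
    = inside ∷ Z , in⊆in W⊆Z , in⊆in Z⊆X , cong suc ∣X∣≡1+∣Z∣
  ⊊⇒⊆⋖ {W = outside ∷ W} {outside ∷ X} W⊆X W≢X
    with Z , W⊆Z , (Z⊆X , ∣X∣≡1+∣Z∣) ← ⊊⇒⊆⋖ (drop-∷-⊆ W⊆X) (W≢X ∘ cong (outside ∷_))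
    = outside ∷ Z , out⊆ W⊆Z , out⊆ Z⊆X , ∣X∣≡1+∣Z∣
  ⊊⇒⊆⋖ {W = outside ∷ W} {inside  ∷ X} W⊆X _ = outside ∷ X , out⊆ (drop-∷-⊆ W⊆X) , out⊆ ⊆-refl , refl
  ⊊⇒⊆⋖ {W = inside  ∷ W} {outside ∷ X} W⊆X _ = ⊥-elim (in⊈out W⊆X)

  -- On supersets e of X, the map e ↦ Z ∪ (e ─ X) is injective.
  count-∪─≤count : {B : Pred (Subset n) ℓ} (B? : Decidable B) → Z ⊆ X →
                  count (λ e → X ⊆? e ×-dec B? (Z ∪ (e ─ X))) ≤ count (λ Y → Z ⊆? Y ×-dec B? Y)
  count-∪─≤count {Z = []} {[]} B? _ = ≤-refl
  count-∪─≤count {Z = inside ∷ Z} {inside ∷ X} B? Z⊆X =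
    +-mono-≤ (count-∪─≤count (B? ∘ (inside ∷_)) (drop-∷-⊆ Z⊆X))
             (≤-trans (≤-reflexive (count-none (λ e → inside ∷ X ⊆? outside ∷ e
                                                        ×-dec B? ((inside ∷ Z) ∪ ((outside ∷ e) ─ (inside ∷ X))))
                                               (λ _ → in⊈out ∘ proj₁)))
                      z≤n)
  count-∪─≤count {Z = outside ∷ Z} {inside ∷ X} B? Z⊆X =
    ≤-trans (+-mono-≤ (count-∪─≤count (B? ∘ (outside ∷_)) (drop-∷-⊆ Z⊆X))
                      (≤-reflexive (count-none (λ e → inside ∷ X ⊆? outside ∷ e
                                                        ×-dec B? ((outside ∷ Z) ∪ ((outside ∷ e) ─ (inside ∷ X))))
                                               (λ _ → in⊈out ∘ proj₁))))
            (≤-trans (≤-reflexive (+-identityʳ _)) (m≤n+m _ _))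
  count-∪─≤count {Z = outside ∷ Z} {outside ∷ X} B? Z⊆X =
    +-mono-≤ (count-∪─≤count (B? ∘ (inside ∷_)) (drop-∷-⊆ Z⊆X))
             (count-∪─≤count (B? ∘ (outside ∷_)) (drop-∷-⊆ Z⊆X))
  count-∪─≤count {Z = inside ∷ Z} {outside ∷ X} B? Z⊆X = ⊥-elim (in⊈out Z⊆X)

open Covering

module BadSets {n : ℕ} (K q N : ℕ) (𝒮 : Subset n → Bool) where

  open import Data.Bool using (T; _∧_)
  open import Data.Bool.Properties using (T?; T-∧)
  open import Data.Fin.Subset using (_⊆_; ∣_∣; _∪_; _∩_; _─_)
  open import Data.Fin.Subset.Properties using (_⊆?_; anySubset?; ⊆-refl; ⊆-trans; p⊆q⇒∣p∣≤∣q∣; p∩q⊆q)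
  open import Data.Nat using (zero; suc; _+_; _*_; _∸_; _^_; _≤_; _<_; _≤?_; _<?_; _≡ᵇ_; _<ᵇ_; _≟_)
  open import Data.Nat.Properties
  open import Data.Product using (∃; _×_; _,_; proj₁; proj₂)
  open import Function using (_∘_; id; _⇔_; mk⇔; Equivalence)
  open import Level using (0ℓ)
  open import Relation.Binary.PropositionalEquality
  open import Relation.Nullary using (Dec; yes; no; does; ¬_; contradiction; _×-dec_)
  open import Relation.Unary using (Pred; Decidable)
  open import Relation.Unary.Properties using (_∩?_; ∁?)

  private variable
    X Y Z e : Subset n

  -- badAt i is meant for sets of size K ∸ i: the recursion runs down from the K-sets.
  badAt : ℕ → Subset n → Bool
  badAt zero    Z = 𝒮 Z ∧ (∣ Z ∣ ≡ᵇ K)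
  badAt (suc i) Z = N <ᵇ q * count (λ Y → Z ⋖? Y ×-dec T? (badAt i Y))

  Bad : Pred (Subset n) 0ℓ
  Bad Z = T (badAt (K ∸ ∣ Z ∣) Z)

  bad? : Decidable Bad
  bad? Z = T? (badAt (K ∸ ∣ Z ∣) Z)

  badCovers : Subset n → ℕ
  badCovers Z = count (λ Y → Z ⋖? Y ×-dec bad? Y)

  Bad⇒∣∣≤K : Bad Z → ∣ Z ∣ ≤ K
  Bad⇒∣∣≤K {Z} bad with ∣ Z ∣ ≤? K
  ... | yes ∣Z∣≤K = ∣Z∣≤K
  ... | no  ∣Z∣≰K = contradiction (≤-reflexive (≡ᵇ⇒≡ ∣ Z ∣ K (proj₂ (Equivalence.to T-∧ top)))) ∣Z∣≰K
    where
    top : T (badAt 0 Z)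
    top = subst (λ i → T (badAt i Z)) (m≤n⇒m∸n≡0 (<⇒≤ (≰⇒> ∣Z∣≰K))) bad

  private
    Bad-at : ∀ {i} → K ∸ ∣ Z ∣ ≡ i → Bad Z ⇔ T (badAt i Z)
    Bad-at refl = mk⇔ id id

  Bad-top : ∣ Z ∣ ≡ K → Bad Z ⇔ T (𝒮 Z)
  Bad-top {Z} ∣Z∣≡K = mk⇔ (proj₁ ∘ Equivalence.to T-∧ ∘ to)
                          (λ 𝒮Z → from (Equivalence.from T-∧ (𝒮Z , ≡⇒≡ᵇ ∣ Z ∣ K ∣Z∣≡K)))
    where open Equivalence (Bad-at {Z} (trans (cong (K ∸_) ∣Z∣≡K) (n∸n≡0 K)))

  Bad-below : ∣ Z ∣ < K → Bad Z ⇔ N < q * badCovers Z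
  Bad-below {Z} ∣Z∣<K = mk⇔ (λ bad → subst (N <_) covers≡ (<ᵇ⇒< N _ (to bad)))
                            (λ N< → from (<⇒<ᵇ (subst (N <_) (sym covers≡) N<)))
    where
    open Equivalence (Bad-at {Z} (+-∸-assoc 1 ∣Z∣<K))
    covers≡ : q * count (λ Y → Z ⋖? Y ×-dec T? (badAt (K ∸ suc ∣ Z ∣) Y)) ≡ q * badCovers Z
    covers≡ = cong (q *_) (count-cong (λ Y → Z ⋖? Y ×-dec T? (badAt (K ∸ suc ∣ Z ∣) Y)) (λ Y → Z ⋖? Y ×-dec bad? Y)
                                      (λ { Y (Z⋖Y , b) → Z⋖Y , subst (λ s → T (badAt (K ∸ s) Y)) (sym (proj₂ Z⋖Y)) b })
                                      (λ { Y (Z⋖Y , b) → Z⋖Y , subst (λ s → T (badAt (K ∸ s) Y)) (proj₂ Z⋖Y) b }))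

  Tainted : Pred (Subset n) 0ℓ
  Tainted X = ∃ λ W → W ⊆ X × Bad W

  tainted? : Decidable Tainted
  tainted? X = anySubset? (λ W → W ⊆? X ×-dec bad? W)

  Bad⇒Tainted : Bad X → Tainted X
  Bad⇒Tainted {X} bad = X , ⊆-refl , bad

  Tainted-⊆ : X ⊆ Y → Tainted X → Tainted Y
  Tainted-⊆ X⊆Y (W , W⊆X , bad) = W , ⊆-trans W⊆X X⊆Y , bad

  β : ℕ → ℕ
  β j = count (λ X → bad? X ×-dec ∣ X ∣ ≟ j)

  τ : ℕ → ℕ
  τ j = count (λ X → tainted? X ×-dec ∣ X ∣ ≟ j)

  β-top : β K ≤ count (λ X → T? (𝒮 X) ×-dec ∣ X ∣ ≟ K)
  β-top = count-mono (λ X → bad? X ×-dec ∣ X ∣ ≟ K) (λ X → T? (𝒮 X) ×-dec ∣ X ∣ ≟ K)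
                     (λ { X (bad , ∣X∣≡K) → Equivalence.to (Bad-top ∣X∣≡K) bad , ∣X∣≡K })

  τ₀≤β₀ : τ 0 ≤ β 0
  τ₀≤β₀ = count-mono (λ X → tainted? X ×-dec ∣ X ∣ ≟ 0) (λ X → bad? X ×-dec ∣ X ∣ ≟ 0) empty-bad
    where
    empty-bad : ∀ X → Tainted X × ∣ X ∣ ≡ 0 → Bad X × ∣ X ∣ ≡ 0
    empty-bad X ((W , W⊆X , bad) , ∣X∣≡0)
      with refl ← ⊆[0]⇒≡ (W⊆X , trans ∣X∣≡0 (sym (n≤0⇒n≡0 (≤-trans (p⊆q⇒∣p∣≤∣q∣ W⊆X) (≤-reflexive ∣X∣≡0)))))
      = bad , ∣X∣≡0

  β-step : ∀ j → j < K → N * β j ≤ q * K * β (suc j)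
  β-step j j<K = begin
    N * β j                                ≤⟨ *-count≤∑ (λ Z → bad? Z ×-dec ∣ Z ∣ ≟ j) many-bad-covers ⟩
    ∑ (λ Z → q * count (R? Z))             ≡⟨ ∑-*ˡ q (λ Z → count (R? Z)) ⟩
    q * ∑ (λ Z → count (R? Z))             ≡⟨ cong (q *_) (∑-comm λ Z Y → indicator (does (R? Z Y))) ⟩
    q * ∑ (λ Y → count (λ Z → R? Z Y))     ≤⟨ *-monoʳ-≤ q (∑≤*-count (λ Y → bad? Y ×-dec ∣ Y ∣ ≟ suc j) few-covered none-covered) ⟩
    q * (K * β (suc j))                    ≡⟨ *-assoc q K (β (suc j)) ⟨
    q * K * β (suc j)                      ∎
    where
    open ≤-Reasoning
    R : Subset n → Subset n → Set
    R Z Y = (Bad Z × ∣ Z ∣ ≡ j) × (Z ⋖ Y × Bad Y)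
    R? : ∀ Z Y → Dec (R Z Y)
    R? Z Y = (bad? Z ×-dec ∣ Z ∣ ≟ j) ×-dec (Z ⋖? Y ×-dec bad? Y)
    many-bad-covers : ∀ Z → Bad Z × ∣ Z ∣ ≡ j → N ≤ q * count (R? Z)
    many-bad-covers Z badⱼ@(bad , ∣Z∣≡j) = <⇒≤ (<-≤-trans
      (Equivalence.to (Bad-below {Z} (subst (_< K) (sym ∣Z∣≡j) j<K)) bad)
      (*-monoʳ-≤ q (count-mono (λ Y → Z ⋖? Y ×-dec bad? Y) (R? Z) (λ _ → badⱼ ,_))))
    few-covered : ∀ Y → Bad Y × ∣ Y ∣ ≡ suc j → count (λ Z → R? Z Y) ≤ K
    few-covered Y (_ , ∣Y∣≡1+j) = begin
      count (λ Z → R? Z Y) ≤⟨ count-mono (λ Z → R? Z Y) (_⋖? Y) (λ _ → proj₁ ∘ proj₂) ⟩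
      count (_⋖? Y)       ≤⟨ count-covered Y ⟩
      ∣ Y ∣               ≡⟨ ∣Y∣≡1+j ⟩
      suc j               ≤⟨ j<K ⟩
      K                   ∎
    none-covered : ∀ Y → ¬ (Bad Y × ∣ Y ∣ ≡ suc j) → count (λ Z → R? Z Y) ≡ 0
    none-covered Y ¬badⱼ₊₁ = count-none (λ Z → R? Z Y)
      (λ { Z ((_ , ∣Z∣≡j) , (_ , ∣Y∣≡1+∣Z∣) , bad) → ¬badⱼ₊₁ (bad , trans ∣Y∣≡1+∣Z∣ (cong suc ∣Z∣≡j)) })

  τ-step : ∀ j → τ (suc j) ≤ β (suc j) + n * τ j
  τ-step j = begin
    τ (suc j)                                         ≡⟨ count-split taintedⱼ₊₁? bad? ⟩
    count (taintedⱼ₊₁? ∩? bad?) + count (taintedⱼ₊₁? ∩? ∁? bad?) ≤⟨ +-mono-≤ bad-part good-part ⟩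
    β (suc j) + n * τ j                               ∎
    where
    open ≤-Reasoning
    taintedⱼ₊₁? : Decidable (λ X → Tainted X × ∣ X ∣ ≡ suc j)
    taintedⱼ₊₁? X = tainted? X ×-dec ∣ X ∣ ≟ suc j
    bad-part : count (taintedⱼ₊₁? ∩? bad?) ≤ β (suc j)
    bad-part = count-mono (taintedⱼ₊₁? ∩? bad?) (λ X → bad? X ×-dec ∣ X ∣ ≟ suc j)
                          (λ { X ((_ , ∣X∣≡1+j) , bad) → bad , ∣X∣≡1+j })
    R? : ∀ Z X → Dec ((Tainted Z × ∣ Z ∣ ≡ j) × Z ⋖ X)
    R? Z X = (tainted? Z ×-dec ∣ Z ∣ ≟ j) ×-dec Z ⋖? X
    tainted-below : ∀ X → (Tainted X × ∣ X ∣ ≡ suc j) × ¬ Bad X → ∃ λ Z → (Tainted Z × ∣ Z ∣ ≡ j) × Z ⋖ X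
    tainted-below X (((W , W⊆X , bad) , ∣X∣≡1+j) , ¬bad)
      with Z , W⊆Z , Z⋖X@(_ , ∣X∣≡1+∣Z∣) ← ⊊⇒⊆⋖ W⊆X (λ { refl → ¬bad bad })
      = Z , ((W , W⊆Z , bad) , suc-injective (trans (sym ∣X∣≡1+∣Z∣) ∣X∣≡1+j)) , Z⋖X
    good-part : count (taintedⱼ₊₁? ∩? ∁? bad?) ≤ n * τ j
    good-part = begin
      count (taintedⱼ₊₁? ∩? ∁? bad?) ≤⟨ count≤∑-count (taintedⱼ₊₁? ∩? ∁? bad?) R? tainted-below ⟩
      ∑ (λ Z → count (R? Z))         ≤⟨ ∑≤*-count (λ Z → tainted? Z ×-dec ∣ Z ∣ ≟ j) few-covers none-covers ⟩
      n * τ j                        ∎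
      where
      few-covers : ∀ Z → Tainted Z × ∣ Z ∣ ≡ j → count (R? Z) ≤ n
      few-covers Z _ = ≤-trans (count-mono (R? Z) (Z ⋖?_) (λ _ → proj₂)) (count-covers Z)
      none-covers : ∀ Z → ¬ (Tainted Z × ∣ Z ∣ ≡ j) → count (R? Z) ≡ 0
      none-covers Z ¬taintedⱼ = count-none (R? Z) (λ _ → ¬taintedⱼ ∘ proj₁)

  lost : Subset n → ℕ
  lost X = count (λ e → X ⋖? e ×-dec tainted? e)

  tainted-cover : ¬ Tainted X → X ⋖ e → Tainted e → ∃ λ Z → (Z ⊆ X × ∣ Z ∣ < K) × Bad (Z ∪ (e ─ X))
  tainted-cover {X} {e} ¬tainted X⋖e (W , W⊆e , bad) =
    W ∩ X , (p∩q⊆q W X , ∣W∩X∣<K) , subst Bad (sym W∩X∪e─X≡W) bad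
    where
    W∩X∪e─X≡W : (W ∩ X) ∪ (e ─ X) ≡ W
    W∩X∪e─X≡W = p∩q∪r─q≡p W⊆e X⋖e (λ W⊆X → ¬tainted (W , W⊆X , bad))
    ∣W∩X∣<K : ∣ W ∩ X ∣ < K
    ∣W∩X∣<K = begin-strict
      ∣ W ∩ X ∣               <⟨ n<1+n _ ⟩
      1 + ∣ W ∩ X ∣           ≡⟨ proj₂ (p⊆q⋖r⇒p⋖p∪r─q (p∩q⊆q W X) X⋖e) ⟨
      ∣ (W ∩ X) ∪ (e ─ X) ∣   ≡⟨ cong ∣_∣ W∩X∪e─X≡W ⟩
      ∣ W ∣                   ≤⟨ Bad⇒∣∣≤K {W} bad ⟩
      K                       ∎
      where open ≤-Reasoning

  bad-extensions≤badCovers : Z ⊆ X → count (λ e → X ⋖? e ×-dec bad? (Z ∪ (e ─ X))) ≤ badCovers Z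
  bad-extensions≤badCovers {Z} {X} Z⊆X = begin
    count (λ e → X ⋖? e ×-dec bad? (Z ∪ (e ─ X)))
      ≤⟨ count-mono (λ e → X ⋖? e ×-dec bad? (Z ∪ (e ─ X))) (λ e → X ⊆? e ×-dec covering-bad? (Z ∪ (e ─ X)))
                    (λ { e (X⋖e@(X⊆e , _) , bad) → X⊆e , proj₂ (p⊆q⋖r⇒p⋖p∪r─q Z⊆X X⋖e) , bad }) ⟩
    count (λ e → X ⊆? e ×-dec covering-bad? (Z ∪ (e ─ X)))
      ≤⟨ count-∪─≤count covering-bad? Z⊆X ⟩
    count (λ Y → Z ⊆? Y ×-dec covering-bad? Y)
      ≤⟨ count-mono (λ Y → Z ⊆? Y ×-dec covering-bad? Y) (λ Y → Z ⋖? Y ×-dec bad? Y)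
                    (λ { Y (Z⊆Y , ∣Y∣≡1+∣Z∣ , bad) → (Z⊆Y , ∣Y∣≡1+∣Z∣) , bad }) ⟩
    badCovers Z
      ∎
    where
    open ≤-Reasoning
    covering-bad? : Decidable (λ Y → ∣ Y ∣ ≡ 1 + ∣ Z ∣ × Bad Y)
    covering-bad? Y = ∣ Y ∣ ≟ 1 + ∣ Z ∣ ×-dec bad? Y

  lost-bound : ∣ X ∣ ≡ K → ¬ Tainted X → q * lost X ≤ N * 2 ^ K
  lost-bound {X} ∣X∣≡K ¬tainted = begin
    q * lost X                     ≤⟨ *-monoʳ-≤ q (count≤∑-count (λ e → X ⋖? e ×-dec tainted? e) R? bad-cover) ⟩
    q * ∑ (λ Z → count (R? Z))     ≡⟨ ∑-*ˡ q (λ Z → count (R? Z)) ⟨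
    ∑ (λ Z → q * count (R? Z))     ≤⟨ ∑≤*-count small⊆X? few-bad-covers no-covers ⟩
    N * count small⊆X?             ≤⟨ *-monoʳ-≤ N (count-mono small⊆X? (_⊆? X) (λ _ → proj₁)) ⟩
    N * count (_⊆? X)              ≡⟨ cong (N *_) (trans (count-subsets X) (cong (2 ^_) ∣X∣≡K)) ⟩
    N * 2 ^ K                      ∎
    where
    open ≤-Reasoning
    small⊆X? : Decidable (λ Z → Z ⊆ X × ∣ Z ∣ < K)
    small⊆X? Z = Z ⊆? X ×-dec ∣ Z ∣ <? K
    R? : ∀ Z e → Dec ((Z ⊆ X × ∣ Z ∣ < K) × (X ⋖ e × Bad (Z ∪ (e ─ X))))
    R? Z e = small⊆X? Z ×-dec (X ⋖? e ×-dec bad? (Z ∪ (e ─ X)))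
    bad-cover : ∀ e → X ⋖ e × Tainted e → ∃ λ Z → (Z ⊆ X × ∣ Z ∣ < K) × (X ⋖ e × Bad (Z ∪ (e ─ X)))
    bad-cover e (X⋖e , tainted) with Z , small⊆X , bad ← tainted-cover ¬tainted X⋖e tainted = Z , small⊆X , X⋖e , bad
    few-bad-covers : ∀ Z → Z ⊆ X × ∣ Z ∣ < K → q * count (R? Z) ≤ N
    few-bad-covers Z (Z⊆X , ∣Z∣<K) = begin
      q * count (R? Z)   ≤⟨ *-monoʳ-≤ q (count-mono (R? Z) (λ e → X ⋖? e ×-dec bad? (Z ∪ (e ─ X))) (λ _ → proj₂)) ⟩
      q * count (λ e → X ⋖? e ×-dec bad? (Z ∪ (e ─ X))) ≤⟨ *-monoʳ-≤ q (bad-extensions≤badCovers Z⊆X) ⟩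
      q * badCovers Z    ≤⟨ ≮⇒≥ (¬bad ∘ Equivalence.from (Bad-below {Z} ∣Z∣<K)) ⟩
      N                  ∎
      where
      ¬bad : ¬ Bad Z
      ¬bad bad = ¬tainted (Z , Z⊆X , bad)
    no-covers : ∀ Z → ¬ (Z ⊆ X × ∣ Z ∣ < K) → q * count (R? Z) ≡ 0
    no-covers Z ¬small⊆X = trans (cong (q *_) (count-none (R? Z) (λ _ → ¬small⊆X ∘ proj₁))) (*-zeroʳ q)

module Arithmetic where

  open import Data.Nat
  open import Data.Nat.Combinatorics using (_C_; nCk+nC[k+1]≡[n+1]C[k+1])
  open import Data.Nat.Properties
  open import Data.Nat.Tactic.RingSolver using (solve-∀)
  open import Relation.Binary.PropositionalEquality
  open import Relation.Nullary using (contradiction)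

  *-^-distrib : ∀ a b c → (a * b) ^ c ≡ a ^ c * b ^ c
  *-^-distrib a b zero    = refl
  *-^-distrib a b (suc c) = trans (cong (a * b *_) (*-^-distrib a b c)) (swap a b (a ^ c) (b ^ c))
    where
    swap : ∀ w x y z → w * x * (y * z) ≡ w * y * (x * z)
    swap = solve-∀

  nCk≤n^k : ∀ n k → n C k ≤ n ^ k
  nCk≤n^k n       zero    = ≤-refl
  nCk≤n^k zero    (suc k) = z≤n
  nCk≤n^k (suc n) (suc k) = begin
    suc n C suc k       ≡⟨ nCk+nC[k+1]≡[n+1]C[k+1] n k ⟨
    n C k + n C suc k   ≤⟨ +-mono-≤ (nCk≤n^k n k) (nCk≤n^k n (suc k)) ⟩
    n ^ k + n * n ^ k   ≤⟨ *-monoʳ-≤ (suc n) (^-monoˡ-≤ k (n≤1+n n)) ⟩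
    suc n * suc n ^ k   ∎
    where open ≤-Reasoning

  2*n≤2^n : ∀ n → 1 ≤ n → 2 * n ≤ 2 ^ n
  2*n≤2^n 1             _ = ≤-refl
  2*n≤2^n (suc (suc n)) _ = begin
    2 * (2 + n)             ≡⟨ *-distribˡ-+ 2 1 (suc n) ⟩
    2 + 2 * suc n           ≤⟨ +-mono-≤ (≤-trans (*-monoʳ-≤ 2 (s≤s z≤n)) (2*n≤2^n (suc n) (s≤s z≤n)))
                                        (2*n≤2^n (suc n) (s≤s z≤n)) ⟩
    2 ^ suc n + 2 ^ suc n   ≡⟨ cong (2 ^ suc n +_) (+-identityʳ _) ⟨
    2 ^ suc (suc n)         ∎
    where open ≤-Reasoning

  2*[1+n]∸2≡n+n : ∀ n → 2 * suc n ∸ 2 ≡ n + n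
  2*[1+n]∸2≡n+n n = trans (cong (_∸ 1) (+-suc n (n + 0))) (cong (n +_) (+-identityʳ n))

  n≤2*[n∸k+1] : ∀ {n k} → 2 * k ≤ n → n ≤ 2 * (n ∸ k + 1)
  n≤2*[n∸k+1] {n} {k} 2k≤n = begin
    n                         ≡⟨ m∸n+n≡m (m+n≤o⇒m≤o k 2k≤n) ⟨
    n ∸ k + k                 ≤⟨ +-monoʳ-≤ (n ∸ k) (m+n≤o⇒m≤o∸n k (subst (_≤ n) (cong (k +_) (+-identityʳ k)) 2k≤n)) ⟩
    n ∸ k + (n ∸ k)           ≤⟨ +-mono-≤ (m≤m+n (n ∸ k) 1) (m≤m+n (n ∸ k) 1) ⟩
    (n ∸ k + 1) + (n ∸ k + 1) ≡⟨ cong ((n ∸ k + 1) +_) (+-identityʳ _) ⟨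
    2 * (n ∸ k + 1)           ∎
    where open ≤-Reasoning

  module Recurrence
    (K N n q C : ℕ) (β τ : ℕ → ℕ)
    (1≤K : 1 ≤ K) (1≤N : 1 ≤ N) (n≤2N : n ≤ 2 * N) (4K≤q : 4 * K ≤ q)
    (β-step : ∀ j → j < K → N * β j ≤ q * K * β (suc j))
    (τ-step : ∀ j → τ (suc j) ≤ β (suc j) + n * τ j)
    (τ₀≤β₀ : τ 0 ≤ β 0)
    (βK-bound : β K * q ^ (K + K) ≤ C)
    (C≤n^K : C ≤ n ^ K)
    where

    R : ℕ
    R = q * K

    β-descent : ∀ i j → i + j ≡ K → N ^ i * β j ≤ R ^ i * β K
    β-descent zero    j refl = ≤-refl
    β-descent (suc i) j 1+i+j≡K = begin
      N * N ^ i * β j         ≡⟨ swap₁ N (N ^ i) (β j) ⟩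
      N ^ i * (N * β j)       ≤⟨ *-monoʳ-≤ (N ^ i) (β-step j j<K) ⟩
      N ^ i * (R * β (suc j)) ≡⟨ swap₂ (N ^ i) R (β (suc j)) ⟩
      R * (N ^ i * β (suc j)) ≤⟨ *-monoʳ-≤ R (β-descent i (suc j) (trans (+-suc i j) 1+i+j≡K)) ⟩
      R * (R ^ i * β K)       ≡⟨ *-assoc R (R ^ i) (β K) ⟨
      R * R ^ i * β K         ∎
      where
      open ≤-Reasoning
      j<K : j < K
      j<K = ≤-trans (s≤s (m≤n+m j i)) (≤-reflexive 1+i+j≡K)
      swap₁ : ∀ a b c → a * b * c ≡ b * (a * c)
      swap₁ = solve-∀
      swap₂ : ∀ a b c → a * (b * c) ≡ b * (a * c)
      swap₂ = solve-∀

    private instance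
      N≢0 : NonZero N
      N≢0 = >-nonZero 1≤N
      K≢0 : NonZero K
      K≢0 = >-nonZero 1≤K
      q≢0 : NonZero q
      q≢0 = >-nonZero (≤-trans (≤-trans 1≤K (m≤n*m K 4)) 4K≤q)
      R≢0 : NonZero R
      R≢0 = m*n≢0 q K

    β₀*q^K≤[2K]^K : β 0 * q ^ K ≤ (2 * K) ^ K
    β₀*q^K≤[2K]^K = *-cancelʳ-≤ (β 0 * q ^ K) ((2 * K) ^ K) (q ^ K) {{m^n≢0 q K}}
                      (*-cancelˡ-≤ (N ^ K) {{m^n≢0 N K}} (begin
      N ^ K * (β 0 * q ^ K * q ^ K)      ≡⟨ cong (N ^ K *_) (trans (*-assoc (β 0) _ _) (cong (β 0 *_) (sym (^-distribˡ-+-* q K K)))) ⟩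
      N ^ K * (β 0 * q ^ (K + K))        ≡⟨ *-assoc (N ^ K) (β 0) _ ⟨
      N ^ K * β 0 * q ^ (K + K)          ≤⟨ *-monoˡ-≤ (q ^ (K + K)) (β-descent K 0 (+-identityʳ K)) ⟩
      R ^ K * β K * q ^ (K + K)          ≡⟨ *-assoc (R ^ K) (β K) _ ⟩
      R ^ K * (β K * q ^ (K + K))        ≤⟨ *-monoʳ-≤ (R ^ K) (≤-trans βK-bound C≤n^K) ⟩
      R ^ K * n ^ K                      ≤⟨ *-monoʳ-≤ (R ^ K) (^-monoˡ-≤ K n≤2N) ⟩
      R ^ K * (2 * N) ^ K                ≡⟨ *-^-distrib R (2 * N) K ⟨
      (q * K * (2 * N)) ^ K              ≡⟨ cong (_^ K) (regroup q K N) ⟩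
      (N * (2 * K * q)) ^ K              ≡⟨ *-^-distrib N (2 * K * q) K ⟩
      N ^ K * (2 * K * q) ^ K            ≡⟨ cong (N ^ K *_) (*-^-distrib (2 * K) q K) ⟩
      N ^ K * ((2 * K) ^ K * q ^ K)      ∎))
      where
      open ≤-Reasoning
      regroup : ∀ q K N → q * K * (2 * N) ≡ N * (2 * K * q)
      regroup = solve-∀

    β₀≡0 : β 0 ≡ 0
    β₀≡0 with β 0 | β₀*q^K≤[2K]^K
    ... | zero  | _ = refl
    ... | suc b | le = contradiction (≤-trans (m≤m+n (q ^ K) (b * q ^ K)) le) (<⇒≱ (^-monoˡ-< K 2K<q))
      where
      2K<q : 2 * K < q
      2K<q = <-≤-trans (*-monoˡ-< K {2} {4} (s≤s (s≤s (s≤s z≤n)))) 4K≤q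

    τ-bound : ∀ i j → suc (i + j) ≡ K → N ^ suc i * τ j ≤ 3 ^ j * (R ^ (i + j) * β K)
    τ-bound i zero    _ = ≤-trans (≤-reflexive (trans (cong (N ^ suc i *_) τ₀≡0) (*-zeroʳ (N ^ suc i)))) z≤n
      where
      τ₀≡0 : τ 0 ≡ 0
      τ₀≡0 = n≤0⇒n≡0 (≤-trans τ₀≤β₀ (≤-reflexive β₀≡0))
    τ-bound i (suc j) 1+i+1+j≡K = begin
      N ^ suc i * τ (suc j)                                 ≤⟨ *-monoʳ-≤ (N ^ suc i) (τ-step j) ⟩
      N ^ suc i * (β (suc j) + n * τ j)                     ≡⟨ *-distribˡ-+ (N ^ suc i) _ _ ⟩
      N ^ suc i * β (suc j) + N ^ suc i * (n * τ j)         ≤⟨ +-mono-≤ bad-part tainted-part ⟩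
      X + 2 * (3 ^ j * X)                                   ≤⟨ +-monoˡ-≤ (2 * (3 ^ j * X)) (m≤n*m X (3 ^ j) {{m^n≢0 3 j}}) ⟩
      3 ^ j * X + 2 * (3 ^ j * X)                           ≡⟨ collect (3 ^ j) X ⟩
      3 ^ suc j * X                                         ∎
      where
      open ≤-Reasoning
      X : ℕ
      X = R ^ (i + suc j) * β K
      collect : ∀ a x → a * x + 2 * (a * x) ≡ 3 * a * x
      collect = solve-∀
      i+1+j≡1+i+j : i + suc j ≡ suc i + j
      i+1+j≡1+i+j = +-suc i j
      bad-part : N ^ suc i * β (suc j) ≤ X
      bad-part = begin
        N ^ suc i * β (suc j)   ≤⟨ β-descent (suc i) (suc j) 1+i+1+j≡K ⟩
        R ^ suc i * β K         ≤⟨ *-monoˡ-≤ (β K) (^-monoʳ-≤ R (≤-trans (s≤s (m≤m+n i j)) (≤-reflexive (sym i+1+j≡1+i+j)))) ⟩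
        X                       ∎
      tainted-part : N ^ suc i * (n * τ j) ≤ 2 * (3 ^ j * X)
      tainted-part = begin
        N ^ suc i * (n * τ j)                   ≤⟨ *-monoʳ-≤ (N ^ suc i) (*-monoˡ-≤ (τ j) n≤2N) ⟩
        N ^ suc i * (2 * N * τ j)               ≡⟨ regroup (N ^ suc i) N (τ j) ⟩
        2 * (N ^ suc (suc i) * τ j)             ≤⟨ *-monoʳ-≤ 2 (τ-bound (suc i) j (trans (cong suc (sym i+1+j≡1+i+j)) 1+i+1+j≡K)) ⟩
        2 * (3 ^ j * (R ^ (suc i + j) * β K))   ≡⟨ cong (λ e → 2 * (3 ^ j * (R ^ e * β K))) i+1+j≡1+i+j ⟨
        2 * (3 ^ j * X)                         ∎
        where
        regroup : ∀ a N t → a * (2 * N * t) ≡ 2 * (N * a * t)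
        regroup = solve-∀

    4*3^j*K^j≤q^[1+j] : ∀ j → 4 * 3 ^ j * K ^ j ≤ q ^ suc j
    4*3^j*K^j≤q^[1+j] j = begin
      4 * 3 ^ j * K ^ j           ≤⟨ *-monoˡ-≤ (K ^ j) (*-monoʳ-≤ 4 (^-monoˡ-≤ j (n≤1+n 3))) ⟩
      4 * 4 ^ j * K ^ j           ≤⟨ m≤m*n (4 * 4 ^ j * K ^ j) K ⟩
      4 * 4 ^ j * K ^ j * K       ≡⟨ regroup (4 ^ j) (K ^ j) K ⟩
      4 * K * (4 ^ j * K ^ j)     ≡⟨ cong (4 * K *_) (*-^-distrib 4 K j) ⟨
      (4 * K) ^ suc j             ≤⟨ ^-monoˡ-≤ (suc j) 4K≤q ⟩
      q ^ suc j                   ∎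
      where
      open ≤-Reasoning
      regroup : ∀ a b k → 4 * a * b * k ≡ 4 * k * (a * b)
      regroup = solve-∀

    tainted-top-bound : ∀ j → suc j ≡ K → 2 * q * (n * τ j) ≤ C
    tainted-top-bound j 1+j≡K = begin
      2 * q * (n * τ j)                        ≤⟨ *-monoʳ-≤ (2 * q) (*-monoˡ-≤ (τ j) n≤2N) ⟩
      2 * q * (2 * N * τ j)                    ≡⟨ regroup q N (τ j) ⟩
      4 * q * (N ^ 1 * τ j)                    ≤⟨ *-monoʳ-≤ (4 * q) (τ-bound 0 j 1+j≡K) ⟩
      4 * q * (3 ^ j * (R ^ j * β K))          ≡⟨ cong (λ r → 4 * q * (3 ^ j * (r * β K))) (*-^-distrib q K j) ⟩
      4 * q * (3 ^ j * (q ^ j * K ^ j * β K))  ≡⟨ regroup′ q (3 ^ j) (q ^ j) (K ^ j) (β K) ⟩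
      4 * 3 ^ j * K ^ j * q ^ suc j * β K      ≤⟨ *-monoˡ-≤ (β K) (*-monoˡ-≤ (q ^ suc j) (4*3^j*K^j≤q^[1+j] j)) ⟩
      q ^ suc j * q ^ suc j * β K              ≡⟨ cong (_* β K) (^-distribˡ-+-* q (suc j) (suc j)) ⟨
      q ^ (suc j + suc j) * β K                ≡⟨ cong (λ k → q ^ (k + k) * β K) 1+j≡K ⟩
      q ^ (K + K) * β K                        ≡⟨ *-comm _ (β K) ⟩
      β K * q ^ (K + K)                        ≤⟨ βK-bound ⟩
      C                                        ∎
      where
      open ≤-Reasoning
      regroup : ∀ q N t → 2 * q * (2 * N * t) ≡ 4 * q * (N * 1 * t)
      regroup = solve-∀
      regroup′ : ∀ q a b c d → 4 * q * (a * (b * c * d)) ≡ 4 * a * c * (q * b) * d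
      regroup′ = solve-∀

open Arithmetic

module RationalBounds where

  open import Algebra.Bundles using (CommutativeMonoid)
  open import Data.Integer using (+_; -[1+_]; +≤+; +<+)
  import Data.Integer.Properties as ℤ
  open import Data.Nat as ℕ using (zero; suc; z≤n)
  import Data.Nat.Properties as ℕ
  open import Data.Nat.Divisibility using (∣1⇒≡1)
  open import Data.Product using (∃; _×_; _,_; proj₁; proj₂)
  open import Data.Rational
  open import Data.Rational.Properties
  import Data.Rational.Unnormalised as ℚᵘ
  import Data.Rational.Unnormalised.Properties as ℚᵘ
  open import Data.Sum using (inj₁; inj₂)
  open import Relation.Binary.PropositionalEquality
  open import Relation.Nullary using (Dec; yes; no; ¬_; contradiction)
  open import Algebra.Properties.CommutativeSemigroup (CommutativeMonoid.commutativeSemigroup *-1-commutativeMonoid)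
    using (interchange)

  private
    ℕ→ℚ≡mkℚ : ∀ a → ℕ→ℚ a ≡ mkℚ (+ a) 0 (λ (_ , d∣1) → ∣1⇒≡1 d∣1)
    ℕ→ℚ≡mkℚ a = normalize-coprime _

  ℕ→ℚ-+ : ∀ a b → ℕ→ℚ (a ℕ.+ b) ≡ ℕ→ℚ a + ℕ→ℚ b
  ℕ→ℚ-+ a b rewrite ℕ→ℚ≡mkℚ a | ℕ→ℚ≡mkℚ b =
    /-cong (trans (ℤ.pos-+ a b) (sym (cong₂ Data.Integer._+_ (ℤ.*-identityʳ (+ a)) (ℤ.*-identityʳ (+ b))))) refl

  ℕ→ℚ-* : ∀ a b → ℕ→ℚ (a ℕ.* b) ≡ ℕ→ℚ a * ℕ→ℚ b
  ℕ→ℚ-* a b rewrite ℕ→ℚ≡mkℚ a | ℕ→ℚ≡mkℚ b = /-cong (ℤ.pos-* a b) refl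

  ℕ→ℚ-mono-≤ : ∀ {a b} → a ℕ.≤ b → ℕ→ℚ a ≤ ℕ→ℚ b
  ℕ→ℚ-mono-≤ {a} {b} a≤b rewrite ℕ→ℚ≡mkℚ a | ℕ→ℚ≡mkℚ b =
    *≤* (subst₂ Data.Integer._≤_ (sym (ℤ.*-identityʳ (+ a))) (sym (ℤ.*-identityʳ (+ b))) (+≤+ a≤b))

  ℕ→ℚ-cancel-≤ : ∀ {a b} → ℕ→ℚ a ≤ ℕ→ℚ b → a ℕ.≤ b
  ℕ→ℚ-cancel-≤ {a} {b} a≤b rewrite ℕ→ℚ≡mkℚ a | ℕ→ℚ≡mkℚ b with a≤b
  ... | *≤* a*1≤b*1 = ℤ.drop‿+≤+ (subst₂ Data.Integer._≤_ (ℤ.*-identityʳ (+ a)) (ℤ.*-identityʳ (+ b)) a*1≤b*1)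

  ℕ→ℚ-cancel-< : ∀ {a b} → ℕ→ℚ a < ℕ→ℚ b → a ℕ.< b
  ℕ→ℚ-cancel-< {a} {b} a<b rewrite ℕ→ℚ≡mkℚ a | ℕ→ℚ≡mkℚ b with a<b
  ... | *<* a*1<b*1 = ℤ.drop‿+<+ (subst₂ Data.Integer._<_ (ℤ.*-identityʳ (+ a)) (ℤ.*-identityʳ (+ b)) a*1<b*1)

  ℕ→ℚ-nonNeg : ∀ a → 0ℚ ≤ ℕ→ℚ a
  ℕ→ℚ-nonNeg a = ℕ→ℚ-mono-≤ {0} {a} z≤n

  ^ℚ-nonNeg : ∀ m {x} → 0ℚ ≤ x → 0ℚ ≤ x ^ℚ m
  ^ℚ-nonNeg zero    _   = ℕ→ℚ-nonNeg 1
  ^ℚ-nonNeg (suc m) {x} 0≤x = ≤-trans (≤-reflexive (sym (*-zeroˡ (x ^ℚ m))))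
                                      (*-monoʳ-≤-nonNeg (x ^ℚ m) {{nonNegative (^ℚ-nonNeg m 0≤x)}} 0≤x)

  ^ℚ-mono-≤ : ∀ m {x y} → 0ℚ ≤ x → x ≤ y → x ^ℚ m ≤ y ^ℚ m
  ^ℚ-mono-≤ zero    _   _   = ≤-refl
  ^ℚ-mono-≤ (suc m) {x} {y} 0≤x x≤y =
    ≤-trans (*-monoʳ-≤-nonNeg (x ^ℚ m) {{nonNegative (^ℚ-nonNeg m 0≤x)}} x≤y)
            (*-monoˡ-≤-nonNeg y {{nonNegative (≤-trans 0≤x x≤y)}} (^ℚ-mono-≤ m 0≤x x≤y))

  *-^ℚ-distrib : ∀ m x y → (x * y) ^ℚ m ≡ x ^ℚ m * y ^ℚ m
  *-^ℚ-distrib zero    x y = refl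
  *-^ℚ-distrib (suc m) x y = trans (cong (x * y *_) (*-^ℚ-distrib m x y)) (interchange x y (x ^ℚ m) (y ^ℚ m))

  ℕ→ℚ-^ : ∀ a m → ℕ→ℚ (a ℕ.^ m) ≡ ℕ→ℚ a ^ℚ m
  ℕ→ℚ-^ a zero    = refl
  ℕ→ℚ-^ a (suc m) = trans (ℕ→ℚ-* a (a ℕ.^ m)) (cong (ℕ→ℚ a *_) (ℕ→ℚ-^ a m))

  LeMulRoot-≤ : ∀ m θ a {x} y → x ≤ y → y ^ℚ m ≤ θ * a ^ℚ m → LeMulRoot m θ a x
  LeMulRoot-≤ m θ a {x} y x≤y y^m≤θa^m with x ≤? 0ℚ
  ... | yes x≤0 = inj₁ x≤0
  ... | no  x≰0 = inj₂ (≤-trans (^ℚ-mono-≤ m (<⇒≤ (≰⇒> x≰0)) x≤y) y^m≤θa^m)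

  -- 1 ≤ θ Q^m says 1/Q ≤ θ^{1/m}, so Q y ≤ a gives y ≤ a θ^{1/m}.
  ^ℚ≤θ*^ℚ : ∀ m {θ Q y a} → 0ℚ ≤ θ → 0ℚ ≤ Q → 0ℚ ≤ y → 1ℚ ≤ θ * Q ^ℚ m → Q * y ≤ a → y ^ℚ m ≤ θ * a ^ℚ m
  ^ℚ≤θ*^ℚ m {θ} {Q} {y} {a} 0≤θ 0≤Q 0≤y 1≤θQ^m Qy≤a = begin
    y ^ℚ m                   ≡⟨ *-identityˡ (y ^ℚ m) ⟨
    1ℚ * y ^ℚ m              ≤⟨ *-monoʳ-≤-nonNeg (y ^ℚ m) {{nonNegative (^ℚ-nonNeg m 0≤y)}} 1≤θQ^m ⟩
    θ * Q ^ℚ m * y ^ℚ m      ≡⟨ *-assoc θ (Q ^ℚ m) (y ^ℚ m) ⟩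
    θ * (Q ^ℚ m * y ^ℚ m)    ≡⟨ cong (θ *_) (*-^ℚ-distrib m Q y) ⟨
    θ * (Q * y) ^ℚ m         ≤⟨ *-monoˡ-≤-nonNeg θ {{nonNegative 0≤θ}} (^ℚ-mono-≤ m (0≤Qy) Qy≤a) ⟩
    θ * a ^ℚ m               ∎
    where
    open ≤-Reasoning
    0≤Qy : 0ℚ ≤ Q * y
    0≤Qy = ≤-trans (≤-reflexive (sym (*-zeroˡ y))) (*-monoʳ-≤-nonNeg y {{nonNegative 0≤y}} 0≤Q)

  archimedean : ∀ θ → 0ℚ < θ → ∃ λ M → 1ℚ < θ * ℕ→ℚ M
  archimedean θ@(mkℚ (+ suc a) d _) _ = suc (suc d) , toℚᵘ-cancel-<
    (ℚᵘ.<-respʳ-≃ (ℚᵘ.≃-sym (toℚᵘ-homo-* θ (ℕ→ℚ (suc (suc d))))) 1<θ*[2+d])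
    where
    d+1<[a+1]*[d+2] : suc d ℕ.< suc a ℕ.* suc (suc d)
    d+1<[a+1]*[d+2] = ℕ.<-≤-trans (ℕ.n<1+n (suc d)) (ℕ.m≤n*m (suc (suc d)) (suc a))
    1<θ*[2+d] : toℚᵘ 1ℚ ℚᵘ.< toℚᵘ θ ℚᵘ.* toℚᵘ (ℕ→ℚ (suc (suc d)))
    1<θ*[2+d] rewrite ℕ→ℚ≡mkℚ (suc (suc d)) =
      ℚᵘ.*<* (+<+ (subst₂ ℕ._<_ (sym (ℕ.*-identityˡ (suc d ℕ.* 1))) (sym (ℕ.*-identityʳ (suc a ℕ.* suc (suc d))))
                              (subst (ℕ._< suc a ℕ.* suc (suc d)) (sym (ℕ.*-identityʳ (suc d))) d+1<[a+1]*[d+2])))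
  archimedean (mkℚ (+ zero)   _ _) θ>0 with () ← positive θ>0
  archimedean (mkℚ -[1+ _ ] _ _) θ>0 with () ← positive θ>0

  p≤q+r⇒p-q≤r : ∀ {p q r} → p ≤ q + r → p - q ≤ r
  p≤q+r⇒p-q≤r {p} {q} {r} p≤q+r = begin
    p - q         ≤⟨ +-monoˡ-≤ (- q) p≤q+r ⟩
    q + r - q     ≡⟨ cong (_- q) (+-comm q r) ⟩
    r + q - q     ≡⟨ +-assoc r q (- q) ⟩
    r + (q - q)   ≡⟨ cong (λ x → r + x) (+-inverseʳ q) ⟩
    r + 0ℚ        ≡⟨ +-identityʳ r ⟩
    r             ∎
    where open ≤-Reasoning

  crossing : ∀ {ℓ} {P : ℕ → Set ℓ} → (∀ i → Dec (P i)) → P 0 → ∀ M → ¬ P M → ∃ λ i → P i × ¬ P (suc i)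
  crossing P? P0 zero    ¬PM = contradiction P0 ¬PM
  crossing P? P0 (suc M) ¬PM with P? M
  ... | yes PM  = M , PM , ¬PM
  ... | no  ¬PM′ = crossing P? P0 M ¬PM′

  threshold : ∀ m θ → 1 ℕ.≤ m → 0ℚ < θ → θ ≤ 1ℚ → ∃ λ q → θ * ℕ→ℚ (q ℕ.^ m) ≤ 1ℚ × 1ℚ < θ * ℕ→ℚ (suc q ℕ.^ m)
  threshold zero     θ () 0<θ θ≤1
  threshold m@(suc m′) θ 1≤m 0<θ θ≤1 =
    let i , θ[1+i]^m≤1 , θ[2+i]^m≰1 = crossing P? P0 M ¬PM in suc i , θ[1+i]^m≤1 , ≰⇒> θ[2+i]^m≰1
    where
    P : ℕ → Set
    P i = θ * ℕ→ℚ (suc i ℕ.^ m) ≤ 1ℚ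
    P? : ∀ i → Dec (P i)
    P? i = θ * ℕ→ℚ (suc i ℕ.^ m) ≤? 1ℚ
    P0 : P 0
    P0 = ≤-trans (≤-reflexive (trans (cong (λ x → θ * ℕ→ℚ x) (ℕ.^-zeroˡ m)) (*-identityʳ θ))) θ≤1
    M : ℕ
    M = proj₁ (archimedean θ 0<θ)
    ¬PM : ¬ P M
    ¬PM θ[1+M]^m≤1 = <-irrefl refl (<-≤-trans (proj₂ (archimedean θ 0<θ)) (≤-trans θM≤θ[1+M]^m θ[1+M]^m≤1))
      where
      M≤[1+M]^m : M ℕ.≤ suc M ℕ.^ m
      M≤[1+M]^m = ℕ.≤-trans (ℕ.n≤1+n M) (ℕ.m≤m*n (suc M) (suc M ℕ.^ m′) {{ℕ.m^n≢0 (suc M) m′}})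
      θM≤θ[1+M]^m : θ * ℕ→ℚ M ≤ θ * ℕ→ℚ (suc M ℕ.^ m)
      θM≤θ[1+M]^m = *-monoˡ-≤-nonNeg θ {{nonNegative (<⇒≤ 0<θ)}} (ℕ→ℚ-mono-≤ M≤[1+M]^m)

open RationalBounds

module EdgeRemoval where

  open import Data.Bool using (T; _∧_; not)
  open import Data.Bool.Properties using (T?; T-∧)
  open import Data.Fin.Subset using (_⊆_; ∣_∣)
  open import Data.Fin.Subset.Properties using (_⊆?_)
  open import Data.Nat using (suc; _+_; _∸_; _≤_)
  open import Data.Nat.Properties using (≤-reflexive; +-mono-≤; +-comm; ≤-trans; module ≤-Reasoning)
  open import Data.Product using (_×_; _,_; proj₁; proj₂)
  open import Function using (_∘_; Equivalence)
  open import Level using (Level)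
  open import Relation.Binary.PropositionalEquality
  open import Relation.Nullary using (¬_; _×-dec_)
  open import Relation.Nullary.Decidable using (isYes; fromWitness; toWitnessFalse; fromWitnessFalse)
  open import Relation.Unary using (Pred; Decidable)
  open import Relation.Unary.Properties using (_∩?_; ∁?)

  private variable
    k n : ℕ
    ℓ : Level

  removeEdges : {D : Pred (Subset n) ℓ} → KGraph k n → Decidable D → KGraph k n
  removeEdges H D? = record
    { edge    = λ e → edge H e ∧ not (isYes (D? e))
    ; uniform = λ e → uniform H e ∘ proj₁ ∘ Equivalence.to T-∧
    }

  removeEdges-⊑ : {D : Pred (Subset n) ℓ} (H : KGraph k n) (D? : Decidable D) → removeEdges H D? ⊑ H
  removeEdges-⊑ H D? e = proj₁ ∘ Equivalence.to T-∧

  deg-removeEdges : {D : Pred (Subset n) ℓ} (H : KGraph k n) (D? : Decidable D) {X : Subset n} → k ≡ suc ∣ X ∣ →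
                    deg H X ≤ deg (removeEdges H D?) X + count (λ e → X ⋖? e ×-dec D? e)
  deg-removeEdges {n = n} H D? {X} k≡1+∣X∣ = begin
    deg H X                                           ≡⟨ length-filter-allSubsets edge⊇X? ⟩
    count edge⊇X?                                     ≡⟨ count-split edge⊇X? D? ⟩
    count (edge⊇X? ∩? D?) + count (edge⊇X? ∩? ∁? D?)  ≤⟨ +-mono-≤ removed kept ⟩
    count (λ e → X ⋖? e ×-dec D? e) + deg (removeEdges H D?) X ≡⟨ +-comm (count (λ e → X ⋖? e ×-dec D? e)) _ ⟩
    deg (removeEdges H D?) X + count (λ e → X ⋖? e ×-dec D? e) ∎
    where
    open ≤-Reasoning
    edge⊇X? : Decidable (λ e → T (edge H e) × X ⊆ e)
    edge⊇X? e = T? (edge H e) ×-dec X ⊆? e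
    removed : count (edge⊇X? ∩? D?) ≤ count (λ e → X ⋖? e ×-dec D? e)
    removed = count-mono (edge⊇X? ∩? D?) (λ e → X ⋖? e ×-dec D? e)
                (λ { e ((e∈H , X⊆e) , De) → (X⊆e , trans (uniform H e e∈H) k≡1+∣X∣) , De })
    kept : count (edge⊇X? ∩? ∁? D?) ≤ deg (removeEdges H D?) X
    kept = ≤-trans (count-mono (edge⊇X? ∩? ∁? D?) (λ e → T? (edge (removeEdges H D?) e) ×-dec X ⊆? e)
                     (λ { e ((e∈H , X⊆e) , ¬De) → Equivalence.from T-∧ (e∈H , fromWitnessFalse {a? = D? e} ¬De) , X⊆e }))
                   (≤-reflexive (sym (length-filter-allSubsets (λ e → T? (edge (removeEdges H D?) e) ×-dec X ⊆? e))))

  removeEdges-stronglyDense : {D : Pred (Subset n) ℓ} (H : KGraph k n) (D? : Decidable D) {DegOK SizeOK : ℕ → Set} →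
    (∀ {X e} → X ⊆ e → D X → D e) →
    SizeOK (familySize (k ∸ 1) (isYes ∘ D?)) →
    (∀ X → ∣ X ∣ ≡ k ∸ 1 → ¬ D X → DegOK (deg (removeEdges H D?) X)) →
    StronglyDenseWrt (removeEdges H D?) DegOK SizeOK
  removeEdges-stronglyDense H D? D-up size-ok deg-ok =
    (isYes ∘ D? , size-ok , λ X ∣X∣ ¬DX → deg-ok X ∣X∣ (¬DX ∘ fromWitness {a? = D? X})) ,
    λ e X e∈H′ X⊆e ∣X∣ → deg-ok X ∣X∣ (toWitnessFalse {a? = D? e} (proj₂ (Equivalence.to T-∧ e∈H′)) ∘ D-up X⊆e)

open EdgeRemoval

module Cases where

  open import Data.Bool using (T)
  open import Data.Bool.Properties using (T?)
  open import Data.Fin.Subset using (∣_∣)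
  open import Data.Nat as ℕ using (suc; _∸_; z≤n; s≤s)
  open import Data.Nat.Combinatorics using (_C_)
  import Data.Nat.Properties as ℕ
  open import Data.Nat.Tactic.RingSolver using (solve-∀)
  open import Data.Product using (Σ; _×_; _,_; proj₁; proj₂)
  open import Data.Rational using (ℚ; 0ℚ; 1ℚ; _+_; _*_; _-_; _≤_; _<_; nonNegative)
  open import Data.Rational.Properties
    using (≤-trans; ≤-reflexive; *-monoˡ-≤-nonNeg; *-monoʳ-≤-nonNeg; +-identityˡ; +-identityʳ; +-monoˡ-≤; <⇒≤;
           *-identityʳ; *-comm; *-assoc; *-cancelˡ-<-nonNeg; ≰⇒>; module ≤-Reasoning)
  open import Data.Sum using (inj₁)
  open import Function using (_∘_; Equivalence)
  open import Relation.Binary.PropositionalEquality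
  open import Relation.Nullary using (¬_; _×-dec_)
  open import Relation.Nullary.Decidable using (isYes; toWitness; fromWitness)
  open import Relation.Unary using (Decidable)

  small-μ⇒stronglyDense : ∀ {k n} (H : KGraph k n) (μ θ : ℚ) → 0ℚ ≤ μ →
    μ ^ℚ (2 ℕ.* k ∸ 2) ≤ θ * ℕ→ℚ (2 ℕ.^ k) ^ℚ (2 ℕ.* k ∸ 2) → Dense H μ θ → StronglyDenseShifted H μ θ
  small-μ⇒stronglyDense {k} {n} H μ θ 0≤μ μ^m≤θ[2^k]^m (𝒮 , 𝒮-small , _) =
    (𝒮 , inj₁ (p≤q+r⇒p-q≤r (≤-trans 𝒮-small (≤-reflexive (sym (+-identityʳ _))))) , λ S _ _ → any-degree (deg H S)) ,
    λ _ X _ _ _ → any-degree (deg H X)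
    where
    m N : ℕ
    m = 2 ℕ.* k ∸ 2
    N = n ∸ k ℕ.+ 1
    any-degree : ∀ d → LeMulRoot m θ (ℕ→ℚ (2 ℕ.^ k ℕ.* N)) (μ * ℕ→ℚ N - ℕ→ℚ d)
    any-degree d = LeMulRoot-≤ m θ (ℕ→ℚ (2 ℕ.^ k ℕ.* N)) (μ * ℕ→ℚ N)
      (p≤q+r⇒p-q≤r (≤-trans (≤-reflexive (sym (+-identityˡ (μ * ℕ→ℚ N)))) (+-monoˡ-≤ (μ * ℕ→ℚ N) (ℕ→ℚ-nonNeg d))))
      (begin
        (μ * ℕ→ℚ N) ^ℚ m                       ≡⟨ *-^ℚ-distrib m μ (ℕ→ℚ N) ⟩
        μ ^ℚ m * ℕ→ℚ N ^ℚ m                    ≤⟨ *-monoʳ-≤-nonNeg (ℕ→ℚ N ^ℚ m) {{nonNegative (^ℚ-nonNeg m (ℕ→ℚ-nonNeg N))}}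
                                                                     μ^m≤θ[2^k]^m ⟩
        θ * ℕ→ℚ (2 ℕ.^ k) ^ℚ m * ℕ→ℚ N ^ℚ m    ≡⟨ *-assoc θ _ _ ⟩
        θ * (ℕ→ℚ (2 ℕ.^ k) ^ℚ m * ℕ→ℚ N ^ℚ m)  ≡⟨ cong (θ *_) (trans (cong (_^ℚ m) (ℕ→ℚ-* (2 ℕ.^ k) N)) (*-^ℚ-distrib m _ _)) ⟨
        θ * ℕ→ℚ (2 ℕ.^ k ℕ.* N) ^ℚ m            ∎)
      where open ≤-Reasoning

  ≤-threshold : ∀ m {θ μ} a q → 0ℚ < θ → 0ℚ ≤ μ → μ ≤ 1ℚ →
                ¬ (μ ^ℚ m ≤ θ * ℕ→ℚ a ^ℚ m) → 1ℚ < θ * ℕ→ℚ (suc q ℕ.^ m) → a ℕ.≤ q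
  ≤-threshold m {θ} {μ} a q 0<θ 0≤μ μ≤1 μ^m≰θa^m 1<θ[1+q]^m =
    ℕ.≤-pred (ℕ.≰⇒> λ 1+q≤a → ℕ.<⇒≱ a^m<[1+q]^m (ℕ.^-monoˡ-≤ m 1+q≤a))
    where
    a^m<[1+q]^m : a ℕ.^ m ℕ.< suc q ℕ.^ m
    a^m<[1+q]^m = ℕ→ℚ-cancel-< (*-cancelˡ-<-nonNeg θ {{nonNegative (<⇒≤ 0<θ)}} (begin-strict
      θ * ℕ→ℚ (a ℕ.^ m)       ≡⟨ cong (θ *_) (ℕ→ℚ-^ a m) ⟩
      θ * ℕ→ℚ a ^ℚ m          <⟨ ≰⇒> μ^m≰θa^m ⟩
      μ ^ℚ m                  ≤⟨ ^ℚ-mono-≤ m 0≤μ μ≤1 ⟩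
      1ℚ ^ℚ m                 ≡⟨ trans (sym (ℕ→ℚ-^ 1 m)) (cong ℕ→ℚ (ℕ.^-zeroˡ m)) ⟩
      1ℚ                      <⟨ 1<θ[1+q]^m ⟩
      θ * ℕ→ℚ (suc q ℕ.^ m)   ∎))
      where open ≤-Reasoning

  module Pruning
    (L n q : ℕ) (2k≤n : 2 ℕ.* suc (suc L) ℕ.≤ n) (μ θ : ℚ) (0<θ : 0ℚ < θ)
    (θq^m≤1 : θ * ℕ→ℚ (q ℕ.^ (2 ℕ.* suc (suc L) ∸ 2)) ≤ 1ℚ)
    (1<θ[1+q]^m : 1ℚ < θ * ℕ→ℚ (suc q ℕ.^ (2 ℕ.* suc (suc L) ∸ 2)))
    (2^k≤q : 2 ℕ.^ suc (suc L) ℕ.≤ q)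
    (H : KGraph (suc (suc L)) n) (dense : Dense H μ θ)
    where

    K k m N nCK : ℕ
    K = suc L
    k = suc K
    m = 2 ℕ.* k ∸ 2
    N = n ∸ k ℕ.+ 1
    nCK = n C K

    𝒮 : Subset n → Bool
    𝒮 = proj₁ dense

    open BadSets K q N 𝒮

    H′ : KGraph k n
    H′ = removeEdges H tainted?

    1≤θ[1+q]^m : 1ℚ ≤ θ * ℕ→ℚ (suc q) ^ℚ m
    1≤θ[1+q]^m = ≤-trans (<⇒≤ 1<θ[1+q]^m) (≤-reflexive (cong (θ *_) (ℕ→ℚ-^ (suc q) m)))

    -- This is where the factor 2 in the constant 2^k comes from: θ^{1/m} is only known to exceed 1/(q+1).
    [1+q]*x≤2*q*x : ∀ x → suc q ℕ.* x ℕ.≤ 2 ℕ.* q ℕ.* x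
    [1+q]*x≤2*q*x x = ℕ.*-monoˡ-≤ x (ℕ.≤-trans (ℕ.+-monoˡ-≤ q (ℕ.≤-trans (ℕ.m^n>0 2 k) 2^k≤q))
                                               (ℕ.≤-reflexive (cong (q ℕ.+_) (sym (ℕ.+-identityʳ q)))))

    4K≤q : 4 ℕ.* K ℕ.≤ q
    4K≤q = ℕ.≤-trans (ℕ.≤-reflexive (ℕ.*-assoc 2 2 K)) (ℕ.≤-trans (ℕ.*-monoʳ-≤ 2 (2*n≤2^n K (s≤s z≤n))) 2^k≤q)

    βK≤θnCK : ℕ→ℚ (β K) ≤ θ * ℕ→ℚ nCK
    βK≤θnCK = ≤-trans (ℕ→ℚ-mono-≤ (ℕ.≤-trans β-top (ℕ.≤-reflexive (sym (length-filter-allSubsets 𝒮ₖ?))))) (proj₁ (proj₂ dense))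
      where
      𝒮ₖ? : Decidable (λ S → T (𝒮 S) × ∣ S ∣ ≡ K)
      𝒮ₖ? S = T? (𝒮 S) ×-dec ∣ S ∣ ℕ.≟ K

    βK*q^[K+K]≤nCK : β K ℕ.* q ℕ.^ (K ℕ.+ K) ℕ.≤ nCK
    βK*q^[K+K]≤nCK = ℕ→ℚ-cancel-≤ (begin
      ℕ→ℚ (β K ℕ.* q ℕ.^ (K ℕ.+ K))    ≡⟨ trans (ℕ→ℚ-* (β K) _) (cong (λ e → ℕ→ℚ (β K) * ℕ→ℚ (q ℕ.^ e)) (sym (2*[1+n]∸2≡n+n K))) ⟩
      ℕ→ℚ (β K) * ℕ→ℚ (q ℕ.^ m)        ≤⟨ *-monoʳ-≤-nonNeg (ℕ→ℚ (q ℕ.^ m)) {{nonNegative (ℕ→ℚ-nonNeg (q ℕ.^ m))}} βK≤θnCK ⟩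
      θ * ℕ→ℚ nCK * ℕ→ℚ (q ℕ.^ m)      ≡⟨ trans (cong (_* ℕ→ℚ (q ℕ.^ m)) (*-comm θ (ℕ→ℚ nCK))) (*-assoc (ℕ→ℚ nCK) θ _) ⟩
      ℕ→ℚ nCK * (θ * ℕ→ℚ (q ℕ.^ m))    ≤⟨ *-monoˡ-≤-nonNeg (ℕ→ℚ nCK) {{nonNegative (ℕ→ℚ-nonNeg nCK)}} θq^m≤1 ⟩
      ℕ→ℚ nCK * 1ℚ                      ≡⟨ *-identityʳ (ℕ→ℚ nCK) ⟩
      ℕ→ℚ nCK                           ∎)
      where open ≤-Reasoning

    open Recurrence K N n q nCK β τ (s≤s z≤n) (ℕ.m≤n+m 1 (n ∸ k)) (n≤2*[n∸k+1] {n} {k} 2k≤n) 4K≤q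
                    β-step τ-step τ₀≤β₀ βK*q^[K+K]≤nCK (nCk≤n^k n K)
      using (tainted-top-bound)

    DegreeOK SizeOK : ℕ → Set
    DegreeOK d = LeMulRoot m θ (ℕ→ℚ (2 ℕ.^ k ℕ.* N)) (μ * ℕ→ℚ N - ℕ→ℚ d)
    SizeOK s   = LeMulRoot m θ (ℕ→ℚ nCK) (ℕ→ℚ s - θ * ℕ→ℚ nCK)

    degree-ok : ∀ X → ∣ X ∣ ≡ K → ¬ Tainted X → DegreeOK (deg H′ X)
    degree-ok X ∣X∣≡K ¬tainted =
      LeMulRoot-≤ m θ (ℕ→ℚ (2 ℕ.^ k ℕ.* N)) (ℕ→ℚ (lost X)) (p≤q+r⇒p-q≤r μN≤deg′+lost)
        (^ℚ≤θ*^ℚ m (<⇒≤ 0<θ) (ℕ→ℚ-nonNeg (suc q)) (ℕ→ℚ-nonNeg (lost X)) 1≤θ[1+q]^m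
          (≤-trans (≤-reflexive (sym (ℕ→ℚ-* (suc q) (lost X)))) (ℕ→ℚ-mono-≤ [1+q]*lost≤2^k*N)))
      where
      μN≤deg′+lost : μ * ℕ→ℚ N ≤ ℕ→ℚ (deg H′ X) + ℕ→ℚ (lost X)
      μN≤deg′+lost = ≤-trans (proj₂ (proj₂ dense) X ∣X∣≡K (¬tainted ∘ Bad⇒Tainted ∘ Equivalence.from (Bad-top ∣X∣≡K)))
                             (≤-trans (ℕ→ℚ-mono-≤ (deg-removeEdges H tainted? (cong suc (sym ∣X∣≡K))))
                                      (≤-reflexive (ℕ→ℚ-+ (deg H′ X) (lost X))))
      [1+q]*lost≤2^k*N : suc q ℕ.* lost X ℕ.≤ 2 ℕ.^ k ℕ.* N
      [1+q]*lost≤2^k*N = begin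
        suc q ℕ.* lost X          ≤⟨ [1+q]*x≤2*q*x (lost X) ⟩
        2 ℕ.* q ℕ.* lost X        ≡⟨ ℕ.*-assoc 2 q (lost X) ⟩
        2 ℕ.* (q ℕ.* lost X)      ≤⟨ ℕ.*-monoʳ-≤ 2 (lost-bound ∣X∣≡K ¬tainted) ⟩
        2 ℕ.* (N ℕ.* 2 ℕ.^ K)     ≡⟨ regroup N (2 ℕ.^ K) ⟩
        2 ℕ.^ k ℕ.* N             ∎
        where
        open ℕ.≤-Reasoning
        regroup : ∀ a b → 2 ℕ.* (a ℕ.* b) ≡ 2 ℕ.* b ℕ.* a
        regroup = solve-∀

    size-ok : SizeOK (familySize K (isYes ∘ tainted?))
    size-ok = LeMulRoot-≤ m θ (ℕ→ℚ nCK) (ℕ→ℚ (n ℕ.* τ L)) (p≤q+r⇒p-q≤r few-tainted)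
                (^ℚ≤θ*^ℚ m (<⇒≤ 0<θ) (ℕ→ℚ-nonNeg (suc q)) (ℕ→ℚ-nonNeg (n ℕ.* τ L)) 1≤θ[1+q]^m
                  (≤-trans (≤-reflexive (sym (ℕ→ℚ-* (suc q) (n ℕ.* τ L))))
                           (ℕ→ℚ-mono-≤ (ℕ.≤-trans ([1+q]*x≤2*q*x (n ℕ.* τ L)) (tainted-top-bound L refl)))))
      where
      familySize≡τK : familySize K (isYes ∘ tainted?) ≡ τ K
      familySize≡τK = trans (length-filter-allSubsets (λ S → T? (isYes (tainted? S)) ×-dec ∣ S ∣ ℕ.≟ K))
                            (count-cong (λ S → T? (isYes (tainted? S)) ×-dec ∣ S ∣ ℕ.≟ K) (λ X → tainted? X ×-dec ∣ X ∣ ℕ.≟ K)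
                                        (λ { S (t , ∣S∣) → toWitness t , ∣S∣ }) (λ { S (t , ∣S∣) → fromWitness t , ∣S∣ }))
      few-tainted : ℕ→ℚ (familySize K (isYes ∘ tainted?)) ≤ θ * ℕ→ℚ nCK + ℕ→ℚ (n ℕ.* τ L)
      few-tainted = ≤-trans (ℕ→ℚ-mono-≤ (ℕ.≤-trans (ℕ.≤-reflexive familySize≡τK) (τ-step L)))
                            (≤-trans (≤-reflexive (ℕ→ℚ-+ (β K) (n ℕ.* τ L))) (+-monoˡ-≤ (ℕ→ℚ (n ℕ.* τ L)) βK≤θnCK))

    pruned : Σ (KGraph k n) λ H' → H' ⊑ H × StronglyDenseShifted H' μ θ
    pruned = H′ , removeEdges-⊑ H tainted? , removeEdges-stronglyDense H tainted? {DegreeOK} {SizeOK} Tainted-⊆ size-ok degree-ok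

  large-μ⇒pruned : ∀ L n → 2 ℕ.* suc (suc L) ℕ.≤ n → ∀ μ θ → 0ℚ < μ → μ < 1ℚ → 0ℚ < θ → θ < 1ℚ →
    (H : KGraph (suc (suc L)) n) → Dense H μ θ →
    ¬ (μ ^ℚ (2 ℕ.* suc (suc L) ∸ 2) ≤ θ * ℕ→ℚ (2 ℕ.^ suc (suc L)) ^ℚ (2 ℕ.* suc (suc L) ∸ 2)) →
    Σ (KGraph (suc (suc L)) n) λ H' → H' ⊑ H × StronglyDenseShifted H' μ θ
  large-μ⇒pruned L n 2k≤n μ θ 0<μ μ<1 0<θ θ<1 H dense μ-large =
    let q , θq^m≤1 , 1<θ[1+q]^m = threshold m θ 1≤m 0<θ (<⇒≤ θ<1)
    in  Pruning.pruned L n q 2k≤n μ θ 0<θ θq^m≤1 1<θ[1+q]^m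
          (≤-threshold m (2 ℕ.^ suc (suc L)) q 0<θ (<⇒≤ 0<μ) (<⇒≤ μ<1) μ-large 1<θ[1+q]^m) H dense
    where
    m : ℕ
    m = 2 ℕ.* suc (suc L) ∸ 2
    1≤m : 1 ℕ.≤ m
    1≤m = ℕ.≤-trans (s≤s z≤n) (ℕ.≤-reflexive (sym (2*[1+n]∸2≡n+n (suc L))))

open Cases

open import Data.Nat using (suc; _≥_; _*_; _^_; _∸_; s≤s)
open import Data.Product using (Σ; _×_; _,_)
open import Data.Rational using (ℚ; _<_; 0ℚ; 1ℚ)
import Data.Rational as ℚ
import Data.Rational.Properties as ℚ
open import Function using (case_of_)
open import Relation.Nullary using (yes; no)

lemma8p8 : (k n : ℕ) → k ≥ 2 → n ≥ 2 * k → (μ θ : ℚ) →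
    0ℚ < μ → μ < 1ℚ → 0ℚ < θ → θ < 1ℚ →
    (H : KGraph k n) → Dense H μ θ →
    Σ (KGraph k n) (λ H' → (H' ⊑ H) × StronglyDenseShifted H' μ θ)
lemma8p8 1 _ (s≤s ()) _ _ _ _ _ _ _ _
lemma8p8 k@(suc (suc L)) n _ 2k≤n μ θ 0<μ μ<1 0<θ θ<1 H dense =
  case μ ^ℚ (2 * k ∸ 2) ℚ.≤? θ ℚ.* ℕ→ℚ (2 ^ k) ^ℚ (2 * k ∸ 2) of λ where
    (yes μ-small) → H , (λ _ e∈H → e∈H) , small-μ⇒stronglyDense H μ θ (ℚ.<⇒≤ 0<μ) μ-small dense
    (no  μ-large) → large-μ⇒pruned L n 2k≤n μ θ 0<μ μ<1 0<θ θ<1 H dense μ-large
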